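{- Let $\mathcal F$ be a simple graph family and let $\operatorname{Patch}_{\mathcal F}(z,w,u)$ be the generating function of canonically labeled $\mathcal F$-patchworks (of simple graphs). Then for all integers $n,m,t\ge0$, the number $\operatorname{SG}^{\mathcal F}_{n,m,t}$ of simple graphs with vertex set $\{1,\dots,n\}$ and $m$ edges that contain exactly $t$ $\mathcal F$-subgraphs is \[ \operatorname{SG}^{\mathcal F}_{n,m,t}= n!\,[z^n w^m u^t]\, \operatorname{Patch}_{\mathcal F}\!\left(z,\frac{w}{1+w},u-1\right) e^{z}\,(1+w)^{\binom n2}. \]
   Context: Simple graphs have vertices labeled by distinct integers and edges that are unordered pairs of distinct vertices. A simple graph family $\mathcal F$ is a set of graphs with vertex labels $1,\dots,n(H)$, closed under isomorphism; an $\mathcal F$-subgraph of $G$ is a subgraph ($V(F)\subset V(G)$, $E(F)\subset E(G)$) isomorphic to an element of $\mathcal F$. An $\mathcal F$-patchwork $P$ is a finite set (possibly empty) of distinct graphs isomorphic to elements of $\mathcal F$ (its pieces), each with arbitrary distinct integer vertex labels, where vertices of different pieces with the same label are identified, and edges of different pieces joining the same two vertices are identified. $V(P)$, $E(P)$ are the unions over pieces, $n(P)=|V(P)|$, $m(P)=|E(P)|$, $|P|$ is the number of pieces; $P$ is canonically labeled if $V(P)=\{1,\dots,n(P)\}$. Its generating function is $\operatorname{Patch}_{\mathcal F}(z,w,u)=\sum_P u^{|P|} w^{m(P)}\frac{z^{n(P)}}{n(P)!}$ over canonically labeled $\mathcal F$-patchworks. -}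

module Defs where

open import Data.Bool using (Bool; true; false; _∧_; _∨_; if_then_else_; T)
open import Data.Nat using (ℕ; zero; suc; _∸_; _≡ᵇ_)
open import Data.Nat.Properties using (_!≢0)
open import Data.Nat.Combinatorics using (_C_)
open import Data.Nat.Base using (_!)
open import Data.Fin using (Fin; _<?_) renaming (zero to fz; suc to fs)
import Data.Fin as Fin
open import Data.Fin.Subset using (Subset)
open import Data.List using (List; []; _∷_; length; filter; map; foldr; cartesianProduct; allFin; zip; replicate; _++_; lookup)
open import Data.Vec using (Vec; []; _∷_; tabulate; toList) renaming (lookup to vlookup; replicate to vreplicate)
open import Data.Bool.ListAction using (any; all)
open import Data.Product using (_×_; _,_; proj₁; proj₂)
open import Data.Integer using (+_)
open import Data.Rational using (ℚ; 0ℚ; 1ℚ; _+_; _*_; -_; _/_)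
open import Function.Bundles using (_↔_; Inverse)
open import Relation.Nullary using (does)
open import Relation.Binary.PropositionalEquality using (_≡_)

-- all 2-element subsets {i,j} of Fin n, written as pairs (i , j) with i < j
pairs : (n : ℕ) → List (Fin n × Fin n)
pairs n = filter (λ p → proj₁ p <? proj₂ p) (cartesianProduct (allFin n) (allFin n))

npairs : ℕ → ℕ
npairs n = length (pairs n)

EdgeSet : ℕ → Set
EdgeSet n = Subset (npairs n)

_=ᶠ_ : ∀ {n} → Fin n → Fin n → Bool
a =ᶠ b = does (a Fin.≟ b)

adj : ∀ {n} → EdgeSet n → Fin n → Fin n → Bool
adj {n} E a b =
  any (λ pe → proj₂ pe ∧ ((proj₁ (proj₁ pe) =ᶠ a ∧ proj₂ (proj₁ pe) =ᶠ b)
                        ∨ (proj₁ (proj₁ pe) =ᶠ b ∧ proj₂ (proj₁ pe) =ᶠ a)))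
      (zip (pairs n) (toList E))

card : ∀ {k} → Subset k → ℕ
card [] = 0
card (true ∷ v) = suc (card v)
card (false ∷ v) = card v

allSubsets : (k : ℕ) → List (Subset k)
allSubsets zero = [] ∷ []
allSubsets (suc k) = map (true ∷_) (allSubsets k) ++ map (false ∷_) (allSubsets k)

Family : Set
Family = (k : ℕ) → EdgeSet k → Bool

IsoClosed : Family → Set
IsoClosed F = ∀ k (σ : Fin k ↔ Fin k) (E E′ : EdgeSet k) →
  (∀ a b → adj E′ (Inverse.to σ a) (Inverse.to σ b) ≡ adj E a b) → F k E ≡ F k E′

emb : ∀ {n} (V : Subset n) → Fin (card V) → Fin n
emb (true ∷ V) fz = fz
emb (true ∷ V) (fs a) = fs (emb V a)
emb (false ∷ V) a = fs (emb V a)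

relabel : ∀ {n} (V : Subset n) → EdgeSet n → EdgeSet (card V)
relabel V E = tabulate (λ k → adj E (emb V (proj₁ (lookup (pairs (card V)) k)))
                                    (emb V (proj₂ (lookup (pairs (card V)) k))))

allIdx : ∀ {A : Set} (xs : List A) → List (Fin (length xs))
allIdx xs = allFin (length xs)

-- (V , E) is an F-subgraph of the graph with edge set G on Fin n:
-- E ⊆ G, both ends of each edge of E lie in V, and (V , E) is isomorphic
-- to an element of F (witnessed by the order-preserving relabelling; F is
-- closed under isomorphism)
isFSub : Family → (n : ℕ) → EdgeSet n → Subset n → EdgeSet n → Bool
isFSub F n G V E =
  all (λ k → if vlookup E k
             then vlookup G k ∧ vlookup V (proj₁ (lookup (pairs n) k))
                              ∧ vlookup V (proj₂ (lookup (pairs n) k))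
             else true) (allIdx (pairs n))
  ∧ F (card V) (relabel V E)

FSubs : Family → (n : ℕ) → EdgeSet n → List (Subset n × EdgeSet n)
FSubs F n G = filter (λ VE → T? (isFSub F n G (proj₁ VE) (proj₂ VE)))
                     (cartesianProduct (allSubsets n) (allSubsets (npairs n)))
  where
  open import Relation.Nullary.Decidable using (Dec)
  open import Data.Bool.Properties using () renaming (T? to T?)

SG : Family → ℕ → ℕ → ℕ → ℕ
SG F n m t = length (filter (λ G → T? ((card G ≡ᵇ m) ∧ (length (FSubs F n G) ≡ᵇ t)))
                            (allSubsets (npairs n)))
  where open import Data.Bool.Properties using () renaming (T? to T?)

-- Polynomials in u over ℚ (coefficient lists, lowest degree first)

Poly : Set
Poly = List ℚ

padd : Poly → Poly → Poly
padd [] q = q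
padd (a ∷ p) [] = a ∷ p
padd (a ∷ p) (b ∷ q) = (a + b) ∷ padd p q

pscale : ℚ → Poly → Poly
pscale c p = map (c *_) p

pmul : Poly → Poly → Poly
pmul [] q = []
pmul (a ∷ p) q = padd (pscale a q) (0ℚ ∷ pmul p q)

psum : List Poly → Poly
psum = foldr padd []

pmono : ℕ → Poly
pmono t = replicate t 0ℚ ++ (1ℚ ∷ [])

pcoeff : Poly → ℕ → ℚ
pcoeff [] t = 0ℚ
pcoeff (a ∷ p) zero = a
pcoeff (a ∷ p) (suc t) = pcoeff p t

pcomp : Poly → Poly → Poly
pcomp p q = foldr (λ a acc → padd (a ∷ []) (pmul q acc)) [] p

-- Formal power series in z, w with coefficients in ℚ[u]:
-- A N M is the coefficient of z^N w^M

Ser : Set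
Ser = ℕ → ℕ → Poly

sumTo : ℕ → (ℕ → Poly) → Poly
sumTo zero f = f 0
sumTo (suc N) f = padd (sumTo N f) (f (suc N))

_⊛_ : Ser → Ser → Ser
(A ⊛ B) N M = sumTo N (λ i → sumTo M (λ j → pmul (A i j) (B (N ∸ i) (M ∸ j))))

oneS : Ser
oneS zero zero = 1ℚ ∷ []
oneS _ _ = []

serPow : Ser → ℕ → Ser
serPow A zero = oneS
serPow A (suc k) = A ⊛ serPow A k

wSer : (ℕ → ℚ) → Ser
wSer f zero M = f M ∷ []
wSer f (suc N) M = []

ℕ→ℚ : ℕ → ℚ
ℕ→ℚ k = (+ k) / 1

invFact : ℕ → ℚ
invFact k = _/_ (+ 1) (k !) {{k !≢0}}

expZ : Ser
expZ N zero = invFact N ∷ []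
expZ N (suc M) = []

onePlusW : ℕ → ℚ
onePlusW zero = 1ℚ
onePlusW (suc zero) = 1ℚ
onePlusW (suc (suc _)) = 0ℚ

binomW : ℕ → Ser
binomW K = serPow (wSer onePlusW) K

-- w/(1+w) = Σ_{j≥1} (-1)^{j-1} w^j
wOver1+w : ℕ → ℚ
wOver1+w zero = 0ℚ
wOver1+w (suc zero) = 1ℚ
wOver1+w (suc (suc j)) = - wOver1+w (suc j)

-- A(z, w/(1+w), u): [z^N w^M] = Σ_{k ≤ M} A_{N,k} [w^M] (w/(1+w))^k
-- (terms with k > M vanish since w/(1+w) has no constant term)
substW : Ser → Ser
substW A N M = sumTo M (λ k → pscale (pcoeff (serPow (wSer wOver1+w) k 0 M) 0) (A N k))

substU : Ser → Ser
substU A N M = pcomp (A N M) ((- 1ℚ) ∷ 1ℚ ∷ [])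

coeff : Ser → ℕ → ℕ → ℕ → ℚ
coeff A n m t = pcoeff (A n m) t

complete : (n : ℕ) → EdgeSet n
complete n = vreplicate _ true

-- candidate pieces of canonically labelled patchworks on {1..N}:
-- all F-subgraphs of the complete graph (distinct as labelled graphs)
pieces : Family → (N : ℕ) → List (Subset N × EdgeSet N)
pieces F N = FSubs F N (complete N)

-- a patchwork on {1..N} is a subset S of the pieces;
-- selected pieces as a list
selected : ∀ {A : Set} (xs : List A) → Subset (length xs) → List A
selected xs S = map (lookup xs) (filter (λ k → T? (vlookup S k)) (allIdx xs))
  where open import Data.Bool.Properties using () renaming (T? to T?)

coversAll : ∀ {N} → List (Subset N × EdgeSet N) → Bool
coversAll {N} P = all (λ v → any (λ VE → vlookup (proj₁ VE) v) P) (allFin N)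

edgeUnion : ∀ {N} → List (Subset N × EdgeSet N) → EdgeSet N
edgeUnion {N} P = tabulate (λ k → any (λ VE → vlookup (proj₂ VE) k) P)

-- Patch_F(z,w,u) = Σ_P u^{|P|} w^{m(P)} z^{n(P)} / n(P)!  over canonically
-- labelled F-patchworks P
Patch : Family → Ser
Patch F N M =
  pscale (invFact N)
    (psum (map (λ S → pmono (card S))
      (filter (λ S → T? (coversAll (selected (pieces F N) S)
                          ∧ (card (edgeUnion (selected (pieces F N) S)) ≡ᵇ M)))
              (allSubsets (length (pieces F N))))))
  where open import Data.Bool.Properties using () renaming (T? to T?)

module Submission where

-- For a graph G on {1..n} with m edges, inclusion–exclusion over its set of
-- F-subgraphs gives [#F-subgraphs of G = t] = Σ_P [u^t] (u − 1)^{|P|}, the sum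
-- running over the sets P of F-subgraphs of the complete graph ("pieces")
-- whose edges all lie in G.  Summing over G and interchanging the sums, each
-- P is counted with the number of m-edge supersets of its edge union, namely
-- [w^m] (1 + w)^{n C 2} (w/(1+w))^{m(P)}.  Grouping the sets P by their vertex
-- union V and relabelling V onto {1..|V|} turns them into canonically labelled
-- patchworks; the C(n, i) choices of V with |V| = i appear as coefficients.
-- On the other side, n! times the coefficient of z^n w^m u^t in
-- Patch(z, w/(1+w), u − 1) e^z (1 + w)^{n C 2} is extracted factor by factor
-- and gives the same sum.

open import Defs
open import Agda.Primitive using (lzero)
open import Function using (_∘_)
open import Function.Bundles using (mk⇔)
open import Relation.Binary.PropositionalEquality hiding ([_])
open ≡-Reasoning
open import Relation.Binary.Definitions using (tri<; tri≈; tri>)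
open import Relation.Nullary using (Dec; yes; no; does; ¬_)
open import Relation.Nullary.Decidable using (T?)
open import Relation.Unary using (Pred; Decidable)
open import Data.Bool using (Bool; true; false; if_then_else_; _∧_; _∨_; not; T)
open import Data.Bool.ListAction using (any; all)
open import Data.Bool.Properties using (∨-identityʳ; ∧-identityʳ; ∧-zeroʳ; ∨-comm; ∨-zeroʳ)
open import Data.Empty using (⊥; ⊥-elim)
open import Data.Unit using (tt)
open import Data.Sum using (_⊎_; inj₁; inj₂)
open import Data.Product using (_×_; _,_; proj₁; proj₂; ∃-syntax)
open import Data.Maybe as Maybe using (Maybe; just; nothing)
open import Data.Nat as ℕ using (ℕ; zero; suc; _∸_; _≡ᵇ_; _≤_; _<_; z≤n; s≤s; NonZero; _!)
import Data.Nat.Properties as ℕP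
open import Data.Nat.Properties using (_!≢0; _!*_!≢0)
open import Data.Nat.Combinatorics using (_C_; nCk+nC[k+1]≡[n+1]C[k+1]; k>n⇒nCk≡0; nC1≡n; nCk≡n!/k![n-k]!; k![n∸k]!∣n!)
open import Data.Nat.DivMod using (m/n*n≡m)
open import Data.Integer as ℤ using () renaming (+_ to ℤ+_)
import Data.Integer.Properties as ℤP
open import Data.Rational as ℚ using (ℚ; 0ℚ; 1ℚ; _+_; _*_; -_)
open import Data.Rational.Properties as ℚP hiding (_<?_; _≟_)
open import Data.Rational.Solver
open +-*-Solver using (solve; _:+_; _:*_; _:=_; :-_; con)
import Data.Rational.Unnormalised as ℚᵘ
import Data.Rational.Unnormalised.Properties as ℚᵘP
open import Data.Fin as Fin using (Fin; toℕ; _<?_) renaming (zero to fz; suc to fs)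
import Data.Fin.Properties as FP
open import Data.Fin.Subset using (Subset)
open import Data.Vec using (Vec; []; _∷_; toList) renaming (lookup to vlookup; tabulate to vtabulate)
import Data.Vec.Properties as VP
open import Data.List using (List; []; _∷_; map; _++_; filter; length; tabulate; allFin; lookup; zip; cartesianProduct)
open import Data.List.Properties using (length-map)
open import Data.List.Membership.Propositional using (_∈_)
open import Data.List.Membership.Propositional.Properties
  using (∈-filter⁺; ∈-filter⁻; ∈-cartesianProduct⁺; ∈-allFin; ∈-lookup; ∈-map⁺; ∈-map⁻; ∈-++⁺ˡ; ∈-++⁺ʳ)
open import Data.List.Membership.Propositional.Properties.WithK using (unique∧set⇒bag)
open import Data.List.Relation.Unary.Any as Any using (here; there)
open import Data.List.Relation.Unary.Any.Properties using (lookup-index)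
import Data.List.Relation.Unary.All as All
open import Data.List.Relation.Unary.AllPairs using ([]; _∷_)
open import Data.List.Relation.Unary.Unique.Propositional using (Unique)
import Data.List.Relation.Unary.Unique.Propositional.Properties as UP
import Data.List.Relation.Binary.Permutation.Propositional as Perm
open Perm using (_↭_)
open import Data.List.Relation.Binary.Permutation.Propositional.Properties using (↭-length)
open import Data.List.Relation.Binary.BagAndSetEquality using (∼bag⇒↭)


[_] : Bool → ℚ
[ true ] = 1ℚ
[ false ] = 0ℚ

[∧] : ∀ a b → [ a ∧ b ] ≡ [ a ] * [ b ]
[∧] true b = sym (*-identityˡ [ b ])
[∧] false b = sym (*-zeroˡ [ b ])

+-interchange : ∀ a b c d → (a + b) + (c + d) ≡ (a + c) + (b + d)
+-interchange = solve 4 (λ a b c d → (a :+ b) :+ (c :+ d) := (a :+ c) :+ (b :+ d)) refl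

Σ≤ : ℕ → (ℕ → ℚ) → ℚ
Σ≤ zero f = f 0
Σ≤ (suc n) f = Σ≤ n f + f (suc n)

Σ≤-cong : ∀ n {f g : ℕ → ℚ} → (∀ i → i ≤ n → f i ≡ g i) → Σ≤ n f ≡ Σ≤ n g
Σ≤-cong zero h = h 0 z≤n
Σ≤-cong (suc n) h = cong₂ _+_ (Σ≤-cong n (λ i p → h i (ℕP.m≤n⇒m≤1+n p))) (h (suc n) ℕP.≤-refl)

Σ≤-+ : ∀ n (f g : ℕ → ℚ) → Σ≤ n (λ i → f i + g i) ≡ Σ≤ n f + Σ≤ n g
Σ≤-+ zero f g = refl
Σ≤-+ (suc n) f g = begin
  Σ≤ n (λ i → f i + g i) + (f (suc n) + g (suc n))
    ≡⟨ cong (_+ (f (suc n) + g (suc n))) (Σ≤-+ n f g) ⟩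
  (Σ≤ n f + Σ≤ n g) + (f (suc n) + g (suc n))
    ≡⟨ +-interchange (Σ≤ n f) (Σ≤ n g) (f (suc n)) (g (suc n)) ⟩
  (Σ≤ n f + f (suc n)) + (Σ≤ n g + g (suc n)) ∎

Σ≤-*ˡ : ∀ n c (f : ℕ → ℚ) → c * Σ≤ n f ≡ Σ≤ n (λ i → c * f i)
Σ≤-*ˡ zero c f = refl
Σ≤-*ˡ (suc n) c f = trans (*-distribˡ-+ c (Σ≤ n f) (f (suc n))) (cong (_+ c * f (suc n)) (Σ≤-*ˡ n c f))

Σ≤-*ʳ : ∀ n c (f : ℕ → ℚ) → Σ≤ n f * c ≡ Σ≤ n (λ i → f i * c)
Σ≤-*ʳ n c f = trans (*-comm _ c) (trans (Σ≤-*ˡ n c f) (Σ≤-cong n (λ i _ → *-comm c (f i))))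

Σ≤-0 : ∀ n (f : ℕ → ℚ) → (∀ i → i ≤ n → f i ≡ 0ℚ) → Σ≤ n f ≡ 0ℚ
Σ≤-0 zero f h = h 0 z≤n
Σ≤-0 (suc n) f h = trans (cong₂ _+_ (Σ≤-0 n f (λ i p → h i (ℕP.m≤n⇒m≤1+n p))) (h (suc n) ℕP.≤-refl)) (+-identityˡ 0ℚ)

Σ≤-suc : ∀ n (f : ℕ → ℚ) → Σ≤ (suc n) f ≡ f 0 + Σ≤ n (λ i → f (suc i))
Σ≤-suc zero f = refl
Σ≤-suc (suc n) f = begin
  (Σ≤ (suc n) f) + f (suc (suc n)) ≡⟨ cong (_+ f (suc (suc n))) (Σ≤-suc n f) ⟩
  (f 0 + Σ≤ n (λ i → f (suc i))) + f (suc (suc n)) ≡⟨ +-assoc (f 0) _ _ ⟩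
  f 0 + (Σ≤ n (λ i → f (suc i)) + f (suc (suc n))) ∎

Σ≤-single : ∀ n k (f : ℕ → ℚ) → k ≤ n → (∀ i → i ≤ n → i ≢ k → f i ≡ 0ℚ) → Σ≤ n f ≡ f k
Σ≤-single zero .zero f z≤n h = refl
Σ≤-single (suc n) k f k≤ h with k ℕP.≟ suc n
... | yes refl = trans (cong (_+ f (suc n)) (Σ≤-0 n f (λ i p → h i (ℕP.m≤n⇒m≤1+n p) (λ { refl → ℕP.<-irrefl refl (s≤s p) })))) (+-identityˡ _)
... | no k≢ = trans (cong₂ _+_ (Σ≤-single n k f (ℕP.≤-pred (ℕP.≤∧≢⇒< k≤ k≢)) (λ i p ne → h i (ℕP.m≤n⇒m≤1+n p) ne))
                                (h (suc n) ℕP.≤-refl (λ e → k≢ (sym e))))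
                   (+-identityʳ _)

Σ≤-single0 : ∀ n (f : ℕ → ℚ) → (∀ i → i ≢ 0 → f i ≡ 0ℚ) → Σ≤ n f ≡ f 0
Σ≤-single0 n f h = Σ≤-single n 0 f z≤n (λ i _ ne → h i ne)

Σ≤-swap : ∀ n m (f : ℕ → ℕ → ℚ) → Σ≤ n (λ i → Σ≤ m (λ j → f i j)) ≡ Σ≤ m (λ j → Σ≤ n (λ i → f i j))
Σ≤-swap zero m f = refl
Σ≤-swap (suc n) m f = begin
  Σ≤ n (λ i → Σ≤ m (f i)) + Σ≤ m (f (suc n)) ≡⟨ cong (_+ Σ≤ m (f (suc n))) (Σ≤-swap n m f) ⟩
  Σ≤ m (λ j → Σ≤ n (λ i → f i j)) + Σ≤ m (f (suc n)) ≡⟨ sym (Σ≤-+ m _ _) ⟩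
  Σ≤ m (λ j → Σ≤ n (λ i → f i j) + f (suc n) j) ∎

Σl : ∀ {A : Set} → List A → (A → ℚ) → ℚ
Σl [] f = 0ℚ
Σl (x ∷ xs) f = f x + Σl xs f

Σl-cong : ∀ {A : Set} (xs : List A) {f g : A → ℚ} → (∀ x → f x ≡ g x) → Σl xs f ≡ Σl xs g
Σl-cong [] h = refl
Σl-cong (x ∷ xs) h = cong₂ _+_ (h x) (Σl-cong xs h)

Σl-+ : ∀ {A : Set} (xs : List A) (f g : A → ℚ) → Σl xs (λ x → f x + g x) ≡ Σl xs f + Σl xs g
Σl-+ [] f g = sym (+-identityˡ 0ℚ)
Σl-+ (x ∷ xs) f g = trans (cong ((f x + g x) +_) (Σl-+ xs f g))
  (+-interchange (f x) (g x) (Σl xs f) (Σl xs g))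

Σl-*ˡ : ∀ {A : Set} (xs : List A) c (f : A → ℚ) → c * Σl xs f ≡ Σl xs (λ x → c * f x)
Σl-*ˡ [] c f = *-zeroʳ c
Σl-*ˡ (x ∷ xs) c f = trans (*-distribˡ-+ c (f x) _) (cong (c * f x +_) (Σl-*ˡ xs c f))

Σl-++ : ∀ {A : Set} (xs ys : List A) (f : A → ℚ) → Σl (xs ++ ys) f ≡ Σl xs f + Σl ys f
Σl-++ [] ys f = sym (+-identityˡ _)
Σl-++ (x ∷ xs) ys f = trans (cong (f x +_) (Σl-++ xs ys f)) (sym (+-assoc (f x) _ _))

Σl-map : ∀ {A B : Set} (g : A → B) (xs : List A) (f : B → ℚ) → Σl (map g xs) f ≡ Σl xs (λ x → f (g x))
Σl-map g [] f = refl
Σl-map g (x ∷ xs) f = cong (f (g x) +_) (Σl-map g xs f)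

Σl-0 : ∀ {A : Set} (xs : List A) (f : A → ℚ) → (∀ x → f x ≡ 0ℚ) → Σl xs f ≡ 0ℚ
Σl-0 [] f h = refl
Σl-0 (x ∷ xs) f h = trans (cong₂ _+_ (h x) (Σl-0 xs f h)) (+-identityˡ 0ℚ)

Σl-swap : ∀ {A B : Set} (xs : List A) (ys : List B) (f : A → B → ℚ) →
  Σl xs (λ x → Σl ys (f x)) ≡ Σl ys (λ y → Σl xs (λ x → f x y))
Σl-swap [] ys f = sym (Σl-0 ys _ (λ _ → refl))
Σl-swap (x ∷ xs) ys f = trans (cong (Σl ys (f x) +_) (Σl-swap xs ys f)) (sym (Σl-+ ys (f x) _))

Σl-Σ≤ : ∀ {A : Set} (xs : List A) n (f : A → ℕ → ℚ) →
  Σl xs (λ x → Σ≤ n (f x)) ≡ Σ≤ n (λ i → Σl xs (λ x → f x i))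
Σl-Σ≤ [] n f = sym (Σ≤-0 n _ (λ _ _ → refl))
Σl-Σ≤ (x ∷ xs) n f = trans (cong (Σ≤ n (f x) +_) (Σl-Σ≤ xs n f)) (sym (Σ≤-+ n (f x) _))

Σl-filter : ∀ {A : Set} (p : A → Bool) (xs : List A) (f : A → ℚ) →
  Σl (filter (λ y → T? (p y)) xs) f ≡ Σl xs (λ y → [ p y ] * f y)
Σl-filter p [] f = refl
Σl-filter p (x ∷ xs) f with p x
... | true = cong₂ _+_ (sym (*-identityˡ (f x))) (Σl-filter p xs f)
... | false = trans (Σl-filter p xs f) (sym (trans (cong (_+ Σl xs (λ y → [ p y ] * f y)) (*-zeroˡ (f x))) (+-identityˡ _)))

ℕ→ℚ-suc : ∀ n → ℕ→ℚ (suc n) ≡ 1ℚ + ℕ→ℚ n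
ℕ→ℚ-suc n = ℚP.toℚᵘ-injective (beginᵘ
  ℚ.toℚᵘ (ℕ→ℚ (suc n))                   ≈⟨ ℚP.toℚᵘ-fromℚᵘ (ℚᵘ.mkℚᵘ (ℤ+ suc n) 0) ⟩
  ℚᵘ.mkℚᵘ (ℤ+ suc n) 0                    ≈⟨ ℚᵘ.*≡* numerators ⟩
  ℚᵘ.mkℚᵘ (ℤ+ 1) 0 ℚᵘ.+ ℚᵘ.mkℚᵘ (ℤ+ n) 0  ≈⟨ ℚᵘP.+-cong (ℚP.toℚᵘ-fromℚᵘ (ℚᵘ.mkℚᵘ (ℤ+ 1) 0))
                                                        (ℚP.toℚᵘ-fromℚᵘ (ℚᵘ.mkℚᵘ (ℤ+ n) 0)) ⟨
  ℚ.toℚᵘ 1ℚ ℚᵘ.+ ℚ.toℚᵘ (ℕ→ℚ n)          ≈⟨ ℚP.toℚᵘ-homo-+ 1ℚ (ℕ→ℚ n) ⟨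
  ℚ.toℚᵘ (1ℚ + ℕ→ℚ n) ∎ᵘ)
  where
  open ℚᵘP.≃-Reasoning using (step-≈-⟩; step-≈-⟨) renaming (begin_ to beginᵘ_; _∎ to _∎ᵘ)
  numerators : ℤ+ suc n ℤ.* ℤ+ 1 ≡ (ℤ+ 1 ℤ.* ℤ+ 1 ℤ.+ ℤ+ n ℤ.* ℤ+ 1) ℤ.* ℤ+ 1
  numerators = trans (ℤP.*-identityʳ (ℤ+ suc n))
    (sym (trans (ℤP.*-identityʳ _) (cong (λ x → ℤ+ 1 ℤ.+ x) (ℤP.*-identityʳ (ℤ+ n)))))

ℕ→ℚ-+ : ∀ a b → ℕ→ℚ (a ℕ.+ b) ≡ ℕ→ℚ a + ℕ→ℚ b
ℕ→ℚ-+ zero b = sym (+-identityˡ _)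
ℕ→ℚ-+ (suc a) b = begin
  ℕ→ℚ (suc (a ℕ.+ b)) ≡⟨ ℕ→ℚ-suc (a ℕ.+ b) ⟩
  1ℚ + ℕ→ℚ (a ℕ.+ b) ≡⟨ cong (1ℚ +_) (ℕ→ℚ-+ a b) ⟩
  1ℚ + (ℕ→ℚ a + ℕ→ℚ b) ≡⟨ sym (+-assoc 1ℚ (ℕ→ℚ a) (ℕ→ℚ b)) ⟩
  (1ℚ + ℕ→ℚ a) + ℕ→ℚ b ≡⟨ cong (_+ ℕ→ℚ b) (sym (ℕ→ℚ-suc a)) ⟩
  ℕ→ℚ (suc a) + ℕ→ℚ b ∎

length-filter : ∀ {A : Set} (p : A → Bool) (xs : List A) →
  ℕ→ℚ (length (filter (λ y → T? (p y)) xs)) ≡ Σl xs (λ y → [ p y ])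
length-filter p [] = refl
length-filter p (x ∷ xs) with p x
... | true = trans (ℕ→ℚ-suc (length (filter (λ y → T? (p y)) xs))) (cong (1ℚ +_) (length-filter p xs))
... | false = trans (length-filter p xs) (sym (+-identityˡ _))

ℕ→ℚ-* : ∀ a b → ℕ→ℚ (a ℕ.* b) ≡ ℕ→ℚ a * ℕ→ℚ b
ℕ→ℚ-* zero b = sym (*-zeroˡ (ℕ→ℚ b))
ℕ→ℚ-* (suc a) b = begin
  ℕ→ℚ (b ℕ.+ a ℕ.* b) ≡⟨ ℕ→ℚ-+ b (a ℕ.* b) ⟩
  ℕ→ℚ b + ℕ→ℚ (a ℕ.* b) ≡⟨ cong (ℕ→ℚ b +_) (ℕ→ℚ-* a b) ⟩
  ℕ→ℚ b + ℕ→ℚ a * ℕ→ℚ b ≡⟨ solve 2 (λ x y → y :+ x :* y := (con 1ℚ :+ x) :* y) refl (ℕ→ℚ a) (ℕ→ℚ b) ⟩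
  (1ℚ + ℕ→ℚ a) * ℕ→ℚ b ≡⟨ cong (_* ℕ→ℚ b) (sym (ℕ→ℚ-suc a)) ⟩
  ℕ→ℚ (suc a) * ℕ→ℚ b ∎

ℕ→ℚ-*-reciprocal : ∀ d .{{_ : NonZero d}} → ℕ→ℚ d * ((ℤ+ 1) ℚ./ d) ≡ 1ℚ
ℕ→ℚ-*-reciprocal (suc d) = ℚP.toℚᵘ-injective (beginᵘ
  ℚ.toℚᵘ (ℕ→ℚ (suc d) * r)                 ≈⟨ ℚP.toℚᵘ-homo-* (ℕ→ℚ (suc d)) r ⟩
  ℚ.toℚᵘ (ℕ→ℚ (suc d)) ℚᵘ.* ℚ.toℚᵘ r      ≈⟨ ℚᵘP.*-cong (ℚP.toℚᵘ-fromℚᵘ (ℚᵘ.mkℚᵘ (ℤ+ suc d) 0))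
                                                          (ℚP.toℚᵘ-fromℚᵘ (ℚᵘ.mkℚᵘ (ℤ+ 1) d)) ⟩
  ℚᵘ.mkℚᵘ (ℤ+ suc d) 0 ℚᵘ.* ℚᵘ.mkℚᵘ (ℤ+ 1) d  ≈⟨ ℚᵘ.*≡* numerators ⟩
  ℚ.toℚᵘ 1ℚ ∎ᵘ)
  where
  open ℚᵘP.≃-Reasoning using (step-≈-⟩; step-≈-⟨) renaming (begin_ to beginᵘ_; _∎ to _∎ᵘ)
  r : ℚ
  r = (ℤ+ 1) ℚ./ suc d
  numerators : (ℤ+ suc d ℤ.* ℤ+ 1) ℤ.* ℤ+ 1 ≡ ℤ+ 1 ℤ.* (ℤ+ 1 ℤ.* ℤ+ suc d)
  numerators = trans (ℤP.*-identityʳ _) (trans (ℤP.*-identityʳ (ℤ+ suc d))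
    (sym (trans (ℤP.*-identityˡ _) (ℤP.*-identityˡ (ℤ+ suc d)))))

fact-inv : ∀ k → ℕ→ℚ (k !) * invFact k ≡ 1ℚ
fact-inv k = ℕ→ℚ-*-reciprocal (k !) {{k !≢0}}

factorials-to-binomial : ∀ n i → i ≤ n → ℕ→ℚ (n !) * (invFact i * invFact (n ∸ i)) ≡ ℕ→ℚ (n C i)
factorials-to-binomial n i p = begin
  ℕ→ℚ (n !) * (invFact i * invFact (n ∸ i)) ≡⟨ cong (λ z → ℕ→ℚ z * (invFact i * invFact (n ∸ i))) (sym eq) ⟩
  ℕ→ℚ ((n C i) ℕ.* (i ! ℕ.* (n ∸ i) !)) * (invFact i * invFact (n ∸ i))
    ≡⟨ cong (_* (invFact i * invFact (n ∸ i))) (trans (ℕ→ℚ-* (n C i) _) (cong (ℕ→ℚ (n C i) *_) (ℕ→ℚ-* (i !) ((n ∸ i) !)))) ⟩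
  (ℕ→ℚ (n C i) * (ℕ→ℚ (i !) * ℕ→ℚ ((n ∸ i) !))) * (invFact i * invFact (n ∸ i))
    ≡⟨ solve 5 (λ c a b x y → (c :* (a :* b)) :* (x :* y) := c :* ((a :* x) :* (b :* y))) refl
               (ℕ→ℚ (n C i)) (ℕ→ℚ (i !)) (ℕ→ℚ ((n ∸ i) !)) (invFact i) (invFact (n ∸ i)) ⟩
  ℕ→ℚ (n C i) * ((ℕ→ℚ (i !) * invFact i) * (ℕ→ℚ ((n ∸ i) !) * invFact (n ∸ i)))
    ≡⟨ cong (ℕ→ℚ (n C i) *_) (cong₂ _*_ (fact-inv i) (fact-inv (n ∸ i))) ⟩
  ℕ→ℚ (n C i) * (1ℚ * 1ℚ) ≡⟨ *-identityʳ _ ⟩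
  ℕ→ℚ (n C i) ∎
  where
  instance
    nz : NonZero (i ! ℕ.* (n ∸ i) !)
    nz = i !* (n ∸ i) !≢0
  eq : (n C i) ℕ.* (i ! ℕ.* (n ∸ i) !) ≡ n !
  eq = trans (cong (ℕ._* (i ! ℕ.* (n ∸ i) !)) (nCk≡n!/k![n-k]! p)) (m/n*n≡m (k![n∸k]!∣n! p))

≡ᵇ-false : ∀ {e k} → e ≢ k → (e ≡ᵇ k) ≡ false
≡ᵇ-false {e} {k} e≢k with e ≡ᵇ k in eq
... | false = refl
... | true = ⊥-elim (e≢k (ℕP.≡ᵇ⇒≡ e k (subst T (sym eq) tt)))


-- The
-- sequences used below are δ0 (the series 1), ω (the series w/(1+w)) and
-- ρ (the polynomial u − 1); multiplication by w is shift and multiplication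
-- by 1 + w is mul1+w.  The key identity is (1 + w) · w/(1+w) = w.

Seq : Set
Seq = ℕ → ℚ

conv : Seq → Seq → Seq
conv f g n = Σ≤ n (λ i → f i * g (n ∸ i))

⟦_⟧ : Poly → Seq
⟦ p ⟧ = pcoeff p

⟦padd⟧ : ∀ p q t → ⟦ padd p q ⟧ t ≡ ⟦ p ⟧ t + ⟦ q ⟧ t
⟦padd⟧ [] q t = sym (+-identityˡ _)
⟦padd⟧ (a ∷ p) [] zero = sym (+-identityʳ _)
⟦padd⟧ (a ∷ p) [] (suc t) = sym (+-identityʳ _)
⟦padd⟧ (a ∷ p) (b ∷ q) zero = refl
⟦padd⟧ (a ∷ p) (b ∷ q) (suc t) = ⟦padd⟧ p q t

⟦pscale⟧ : ∀ c p t → ⟦ pscale c p ⟧ t ≡ c * ⟦ p ⟧ t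
⟦pscale⟧ c [] t = sym (*-zeroʳ c)
⟦pscale⟧ c (a ∷ p) zero = refl
⟦pscale⟧ c (a ∷ p) (suc t) = ⟦pscale⟧ c p t

⟦pmul⟧ : ∀ p q t → ⟦ pmul p q ⟧ t ≡ conv ⟦ p ⟧ ⟦ q ⟧ t
⟦pmul⟧ [] q t = sym (Σ≤-0 t _ (λ i _ → *-zeroˡ (⟦ q ⟧ (t ∸ i))))
⟦pmul⟧ (a ∷ p) q zero = trans (⟦padd⟧ (pscale a q) (0ℚ ∷ pmul p q) 0)
  (trans (cong (_+ 0ℚ) (⟦pscale⟧ a q 0)) (+-identityʳ _))
⟦pmul⟧ (a ∷ p) q (suc t) = begin
  ⟦ padd (pscale a q) (0ℚ ∷ pmul p q) ⟧ (suc t) ≡⟨ ⟦padd⟧ (pscale a q) (0ℚ ∷ pmul p q) (suc t) ⟩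
  ⟦ pscale a q ⟧ (suc t) + ⟦ pmul p q ⟧ t ≡⟨ cong₂ _+_ (⟦pscale⟧ a q (suc t)) (⟦pmul⟧ p q t) ⟩
  a * ⟦ q ⟧ (suc t) + conv ⟦ p ⟧ ⟦ q ⟧ t ≡⟨ sym (Σ≤-suc t (λ i → ⟦ a ∷ p ⟧ i * ⟦ q ⟧ (suc t ∸ i))) ⟩
  conv ⟦ a ∷ p ⟧ ⟦ q ⟧ (suc t) ∎

⟦sumTo⟧ : ∀ N (f : ℕ → Poly) t → ⟦ sumTo N f ⟧ t ≡ Σ≤ N (λ i → ⟦ f i ⟧ t)
⟦sumTo⟧ zero f t = refl
⟦sumTo⟧ (suc N) f t = trans (⟦padd⟧ (sumTo N f) (f (suc N)) t) (cong (_+ ⟦ f (suc N) ⟧ t) (⟦sumTo⟧ N f t))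

δ0 : Seq
δ0 zero = 1ℚ
δ0 (suc _) = 0ℚ

shift : Seq → Seq
shift f zero = 0ℚ
shift f (suc n) = f n

mul1+w : Seq → Seq
mul1+w f n = f n + shift f n

convPow : Seq → ℕ → Seq
convPow f zero = δ0
convPow f (suc k) = conv f (convPow f k)

mul1+w^ : ℕ → Seq → Seq
mul1+w^ zero f = f
mul1+w^ (suc K) f = mul1+w (mul1+w^ K f)

ω : Seq
ω = wOver1+w

ρ : Seq
ρ = ⟦ (- 1ℚ) ∷ 1ℚ ∷ [] ⟧

conv-congʳ : ∀ (X : Seq) {f g : Seq} → (∀ k → f k ≡ g k) → ∀ n → conv X f n ≡ conv X g n
conv-congʳ X h n = Σ≤-cong n (λ i _ → cong (X i *_) (h (n ∸ i)))

conv-+ʳ : ∀ X f g n → conv X (λ k → f k + g k) n ≡ conv X f n + conv X g n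
conv-+ʳ X f g n = trans (Σ≤-cong n (λ i _ → *-distribˡ-+ (X i) (f (n ∸ i)) (g (n ∸ i)))) (Σ≤-+ n _ _)

conv-*ʳ : ∀ X c f n → conv X (λ k → c * f k) n ≡ c * conv X f n
conv-*ʳ X c f n = trans (Σ≤-cong n (λ i _ → solve 3 (λ a b d → a :* (b :* d) := b :* (a :* d)) refl (X i) c (f (n ∸ i))))
  (sym (Σ≤-*ˡ n c _))

conv-0ʳ : ∀ X f n → (∀ k → f k ≡ 0ℚ) → conv X f n ≡ 0ℚ
conv-0ʳ X f n h = Σ≤-0 n _ (λ i _ → trans (cong (X i *_) (h _)) (*-zeroʳ (X i)))

conv-0ˡ : ∀ X f n → (∀ k → X k ≡ 0ℚ) → conv X f n ≡ 0ℚ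
conv-0ˡ X f n h = Σ≤-0 n _ (λ i _ → trans (cong (_* f (n ∸ i)) (h _)) (*-zeroˡ (f (n ∸ i))))

conv-shiftʳ : ∀ X g n → conv X (shift g) n ≡ shift (conv X g) n
conv-shiftʳ X g zero = *-zeroʳ (X 0)
conv-shiftʳ X g (suc n) = begin
  Σ≤ n (λ i → X i * shift g (suc n ∸ i)) + X (suc n) * shift g (suc n ∸ suc n)
    ≡⟨ cong₂ _+_ (Σ≤-cong n (λ i p → cong (λ z → X i * shift g z) (ℕP.+-∸-assoc 1 p)))
                 (trans (cong (λ z → X (suc n) * shift g z) (ℕP.n∸n≡0 n)) (*-zeroʳ (X (suc n)))) ⟩
  Σ≤ n (λ i → X i * g (n ∸ i)) + 0ℚ ≡⟨ +-identityʳ _ ⟩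
  conv X g n ∎

conv-mul1+wʳ : ∀ X g n → conv X (mul1+w g) n ≡ mul1+w (conv X g) n
conv-mul1+wʳ X g n = trans (conv-+ʳ X g (shift g) n) (cong (conv X g n +_) (conv-shiftʳ X g n))

conv-δ0ʳ : ∀ X n → conv X δ0 n ≡ X n
conv-δ0ʳ X n = trans (Σ≤-single n n _ ℕP.≤-refl h) (trans (cong (λ z → X n * δ0 z) (ℕP.n∸n≡0 n)) (*-identityʳ _))
  where
  h : ∀ i → i ≤ n → i ≢ n → X i * δ0 (n ∸ i) ≡ 0ℚ
  h i p ne with n ∸ i | ℕP.m>n⇒m∸n≢0 (ℕP.≤∧≢⇒< p ne)
  ... | zero | q = ⊥-elim (q refl)
  ... | suc _ | q = *-zeroʳ (X i)

conv-constˡ : ∀ c g t → conv ⟦ c ∷ [] ⟧ g t ≡ c * g t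
conv-constˡ c g t = Σ≤-single0 t _ h
  where
  h : ∀ i → i ≢ 0 → ⟦ c ∷ [] ⟧ i * g (t ∸ i) ≡ 0ℚ
  h zero ne = ⊥-elim (ne refl)
  h (suc i) ne = *-zeroˡ (g (t ∸ suc i))

conv-constʳ : ∀ c f t → conv f ⟦ c ∷ [] ⟧ t ≡ f t * c
conv-constʳ c f t = trans (Σ≤-single t t _ ℕP.≤-refl h) (cong (λ z → f t * ⟦ c ∷ [] ⟧ z) (ℕP.n∸n≡0 t))
  where
  h : ∀ i → i ≤ t → i ≢ t → f i * ⟦ c ∷ [] ⟧ (t ∸ i) ≡ 0ℚ
  h i p ne with t ∸ i | ℕP.m>n⇒m∸n≢0 (ℕP.≤∧≢⇒< p ne)
  ... | zero | q = ⊥-elim (q refl)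
  ... | suc _ | q = *-zeroʳ (f i)

mul1+w-cong : ∀ {f g : Seq} → (∀ k → f k ≡ g k) → ∀ n → mul1+w f n ≡ mul1+w g n
mul1+w-cong h zero = cong₂ _+_ (h 0) refl
mul1+w-cong h (suc n) = cong₂ _+_ (h (suc n)) (h n)

mul1+w^-cong : ∀ K {f g : Seq} → (∀ k → f k ≡ g k) → ∀ n → mul1+w^ K f n ≡ mul1+w^ K g n
mul1+w^-cong zero h = h
mul1+w^-cong (suc K) h = mul1+w-cong (mul1+w^-cong K h)

mul1+w-shift : ∀ f n → mul1+w (shift f) n ≡ shift (mul1+w f) n
mul1+w-shift f zero = +-identityˡ 0ℚ
mul1+w-shift f (suc n) = refl

mul1+w^-shift : ∀ K f n → mul1+w^ K (shift f) n ≡ shift (mul1+w^ K f) n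
mul1+w^-shift zero f n = refl
mul1+w^-shift (suc K) f n = trans (mul1+w-cong (mul1+w^-shift K f) n) (mul1+w-shift (mul1+w^ K f) n)

conv-mul1+w^ : ∀ K X g n → conv X (mul1+w^ K g) n ≡ mul1+w^ K (conv X g) n
conv-mul1+w^ zero X g n = refl
conv-mul1+w^ (suc K) X g n = trans (conv-mul1+wʳ X (mul1+w^ K g) n) (mul1+w-cong (conv-mul1+w^ K X g) n)

-- (1 + w) · w/(1+w) = w, coefficientwise.
ω-step : ∀ i → ω (suc i) + ω i ≡ [ i ≡ᵇ 0 ]
ω-step zero = refl
ω-step (suc i) = +-inverseˡ (ω (suc i))

ω-conv-rec : ∀ y n → conv ω y (suc n) + conv ω y n ≡ y n
ω-conv-rec y n = begin
  conv ω y (suc n) + conv ω y n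
    ≡⟨ cong (_+ conv ω y n) (Σ≤-suc n (λ i → ω i * y (suc n ∸ i))) ⟩
  (0ℚ * y (suc n) + Σ≤ n (λ i → ω (suc i) * y (n ∸ i))) + conv ω y n
    ≡⟨ cong (λ z → (z + Σ≤ n (λ i → ω (suc i) * y (n ∸ i))) + conv ω y n) (*-zeroˡ (y (suc n))) ⟩
  (0ℚ + Σ≤ n (λ i → ω (suc i) * y (n ∸ i))) + conv ω y n
    ≡⟨ cong (_+ conv ω y n) (+-identityˡ (Σ≤ n (λ i → ω (suc i) * y (n ∸ i)))) ⟩
  Σ≤ n (λ i → ω (suc i) * y (n ∸ i)) + conv ω y n
    ≡⟨ sym (Σ≤-+ n _ _) ⟩
  Σ≤ n (λ i → ω (suc i) * y (n ∸ i) + ω i * y (n ∸ i))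
    ≡⟨ Σ≤-cong n (λ i _ → trans (sym (*-distribʳ-+ (y (n ∸ i)) (ω (suc i)) (ω i))) (cong (_* y (n ∸ i)) (ω-step i))) ⟩
  Σ≤ n (λ i → [ i ≡ᵇ 0 ] * y (n ∸ i))
    ≡⟨ Σ≤-single0 n _ h ⟩
  1ℚ * y n ≡⟨ *-identityˡ _ ⟩
  y n ∎
  where
  h : ∀ i → i ≢ 0 → [ i ≡ᵇ 0 ] * y (n ∸ i) ≡ 0ℚ
  h zero ne = ⊥-elim (ne refl)
  h (suc i) ne = *-zeroˡ (y (n ∸ suc i))

mul1+w-ω : ∀ y n → mul1+w (conv ω y) n ≡ shift y n
mul1+w-ω y zero = trans (+-identityʳ (0ℚ * y 0)) (*-zeroˡ (y 0))
mul1+w-ω y (suc n) = ω-conv-rec y n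

ω-conv-0 : ∀ y → conv ω y 0 ≡ 0ℚ
ω-conv-0 y = *-zeroˡ (y 0)

ω-conv-suc : ∀ y n → conv ω y (suc n) ≡ y n + - conv ω y n
ω-conv-suc y n = begin
  conv ω y (suc n) ≡⟨ solve 2 (λ a b → a := (a :+ b) :+ (:- b)) refl (conv ω y (suc n)) (conv ω y n) ⟩
  (conv ω y (suc n) + conv ω y n) + - conv ω y n ≡⟨ cong (_+ - conv ω y n) (ω-conv-rec y n) ⟩
  y n + - conv ω y n ∎

ωPow-vanish : ∀ e j → j < e → convPow ω e j ≡ 0ℚ
ωPow-vanish (suc e) zero p = ω-conv-0 (convPow ω e)
ωPow-vanish (suc e) (suc j) (s≤s p) = begin
  conv ω (convPow ω e) (suc j) ≡⟨ ω-conv-suc (convPow ω e) j ⟩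
  convPow ω e j + - conv ω (convPow ω e) j ≡⟨ cong₂ (λ a b → a + - b) (ωPow-vanish e j p) (ωPow-vanish (suc e) j (ℕP.m≤n⇒m≤1+n p)) ⟩
  0ℚ + - 0ℚ ≡⟨ refl ⟩
  0ℚ ∎

mul1+w^-ωPow-suc : ∀ K e n → mul1+w^ (suc K) (convPow ω (suc e)) n ≡ shift (mul1+w^ K (convPow ω e)) n
mul1+w^-ωPow-suc K e n = trans (mul1+w^-suc K (convPow ω (suc e)) n) (trans (mul1+w^-cong K (mul1+w-ω (convPow ω e)) n) (mul1+w^-shift K (convPow ω e) n))
  where
  mul1+w^-suc : ∀ K f n → mul1+w^ (suc K) f n ≡ mul1+w^ K (mul1+w f) n
  mul1+w^-suc zero f n = refl
  mul1+w^-suc (suc K) f n = mul1+w-cong (mul1+w^-suc K f) n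

-- Σ_{k ≤ j} [w^j](w/(1+w))^k · [e = k] = [w^j](w/(1+w))^e: only k = e
-- survives, and if e > j both sides vanish (ωPow-vanish).
Σ-ωPow-select : ∀ j e → Σ≤ j (λ k → convPow ω k j * [ e ≡ᵇ k ]) ≡ convPow ω e j
Σ-ωPow-select j e with e ℕP.≤? j
... | yes e≤j = trans (Σ≤-single j e _ e≤j (λ k _ k≢e → off k (k≢e ∘ sym))) on
  where
  on : convPow ω e j * [ e ≡ᵇ e ] ≡ convPow ω e j
  on = trans (cong (λ b → convPow ω e j * [ b ]) (≡ᵇ-refl e)) (*-identityʳ _)
    where
    ≡ᵇ-refl : ∀ e → (e ≡ᵇ e) ≡ true
    ≡ᵇ-refl zero = refl
    ≡ᵇ-refl (suc e) = ≡ᵇ-refl e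
  off : ∀ k → e ≢ k → convPow ω k j * [ e ≡ᵇ k ] ≡ 0ℚ
  off k e≢k = trans (cong (λ b → convPow ω k j * [ b ]) (≡ᵇ-false e≢k)) (*-zeroʳ (convPow ω k j))
... | no e≰j = trans (Σ≤-0 j _ off) (sym (ωPow-vanish e j (ℕP.≰⇒> e≰j)))
  where
  off : ∀ k → k ≤ j → convPow ω k j * [ e ≡ᵇ k ] ≡ 0ℚ
  off k k≤j = trans (cong (λ b → convPow ω k j * [ b ]) (≡ᵇ-false {e} {k} (λ { refl → e≰j k≤j }))) (*-zeroʳ (convPow ω k j))

binomial-convolve-ωPow : ∀ K e m →
  Σ≤ m (λ j → mul1+w^ K δ0 (m ∸ j) * convPow ω e j) ≡ mul1+w^ K (convPow ω e) m
binomial-convolve-ωPow K e m = begin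
  Σ≤ m (λ j → mul1+w^ K δ0 (m ∸ j) * convPow ω e j)
    ≡⟨ Σ≤-cong m (λ j _ → *-comm _ (convPow ω e j)) ⟩
  conv (convPow ω e) (mul1+w^ K δ0) m ≡⟨ conv-mul1+w^ K (convPow ω e) δ0 m ⟩
  mul1+w^ K (conv (convPow ω e) δ0) m ≡⟨ mul1+w^-cong K (conv-δ0ʳ (convPow ω e)) m ⟩
  mul1+w^ K (convPow ω e) m ∎

conv-onePlusW : ∀ g n → conv onePlusW g n ≡ mul1+w g n
conv-onePlusW g zero = trans (*-identityˡ (g 0)) (sym (+-identityʳ (g 0)))
conv-onePlusW g (suc n) = begin
  conv onePlusW g (suc n) ≡⟨ Σ≤-suc n (λ i → onePlusW i * g (suc n ∸ i)) ⟩
  1ℚ * g (suc n) + Σ≤ n (λ i → onePlusW (suc i) * g (n ∸ i)) ≡⟨ cong₂ _+_ (*-identityˡ (g (suc n))) (Σ≤-single0 n _ h) ⟩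
  g (suc n) + 1ℚ * g n ≡⟨ cong (g (suc n) +_) (*-identityˡ _) ⟩
  mul1+w g (suc n) ∎
  where
  h : ∀ i → i ≢ 0 → onePlusW (suc i) * g (n ∸ i) ≡ 0ℚ
  h zero ne = ⊥-elim (ne refl)
  h (suc i) ne = *-zeroˡ (g (n ∸ suc i))

onePlusW-pow : ∀ K n → convPow onePlusW K n ≡ mul1+w^ K δ0 n
onePlusW-pow zero n = refl
onePlusW-pow (suc K) n = trans (conv-onePlusW (convPow onePlusW K) n) (mul1+w-cong (onePlusW-pow K) n)

ρ-conv : ∀ g t → conv ρ g t ≡ - g t + shift g t
ρ-conv g zero = solve 1 (λ x → (:- con 1ℚ) :* x := (:- x) :+ con 0ℚ) refl (g 0)
ρ-conv g (suc t) = begin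
  conv ρ g (suc t) ≡⟨ Σ≤-suc t (λ i → ρ i * g (suc t ∸ i)) ⟩
  (- 1ℚ) * g (suc t) + conv ⟦ 1ℚ ∷ [] ⟧ g t
    ≡⟨ cong₂ _+_ (solve 1 (λ x → (:- con 1ℚ) :* x := :- x) refl (g (suc t))) (trans (conv-constˡ 1ℚ g t) (*-identityˡ (g t))) ⟩
  - g (suc t) + g t ∎

⟦oneS⟧ : ∀ N M t → ⟦ oneS N M ⟧ t ≡ δ0 N * (δ0 M * δ0 t)
⟦oneS⟧ zero zero zero = refl
⟦oneS⟧ zero zero (suc t) = refl
⟦oneS⟧ zero (suc M) t = sym (trans (*-identityˡ _) (*-zeroˡ (δ0 t)))
⟦oneS⟧ (suc N) M t = sym (*-zeroˡ (δ0 M * δ0 t))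

serPow-wSer : ∀ f k N M t → ⟦ serPow (wSer f) k N M ⟧ t ≡ δ0 N * (convPow f k M * δ0 t)
serPow-wSer f zero N M t = ⟦oneS⟧ N M t
serPow-wSer f (suc k) N M t = begin
  ⟦ sumTo N (λ i → sumTo M (λ j → pmul (wSer f i j) (serPow (wSer f) k (N ∸ i) (M ∸ j)))) ⟧ t
    ≡⟨ ⟦sumTo⟧ N _ t ⟩
  Σ≤ N (λ i → ⟦ sumTo M (λ j → pmul (wSer f i j) (serPow (wSer f) k (N ∸ i) (M ∸ j))) ⟧ t)
    ≡⟨ Σ≤-single0 N _ h0 ⟩
  ⟦ sumTo M (λ j → pmul (wSer f 0 j) (serPow (wSer f) k N (M ∸ j))) ⟧ t
    ≡⟨ ⟦sumTo⟧ M _ t ⟩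
  Σ≤ M (λ j → ⟦ pmul (f j ∷ []) (serPow (wSer f) k N (M ∸ j)) ⟧ t)
    ≡⟨ Σ≤-cong M (λ j _ → trans (⟦pmul⟧ (f j ∷ []) (serPow (wSer f) k N (M ∸ j)) t)
                          (trans (conv-constˡ (f j) ⟦ serPow (wSer f) k N (M ∸ j) ⟧ t) (cong (f j *_) (serPow-wSer f k N (M ∸ j) t)))) ⟩
  Σ≤ M (λ j → f j * (δ0 N * (convPow f k (M ∸ j) * δ0 t)))
    ≡⟨ Σ≤-cong M (λ j _ → solve 4 (λ a b c d → a :* (b :* (c :* d)) := b :* ((a :* c) :* d)) refl (f j) (δ0 N) (convPow f k (M ∸ j)) (δ0 t)) ⟩
  Σ≤ M (λ j → δ0 N * ((f j * convPow f k (M ∸ j)) * δ0 t))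
    ≡⟨ sym (Σ≤-*ˡ M (δ0 N) _) ⟩
  δ0 N * Σ≤ M (λ j → (f j * convPow f k (M ∸ j)) * δ0 t)
    ≡⟨ cong (δ0 N *_) (sym (Σ≤-*ʳ M (δ0 t) _)) ⟩
  δ0 N * (convPow f (suc k) M * δ0 t) ∎
  where
  h0 : ∀ i → i ≢ 0 → ⟦ sumTo M (λ j → pmul (wSer f i j) (serPow (wSer f) k (N ∸ i) (M ∸ j))) ⟧ t ≡ 0ℚ
  h0 zero ne = ⊥-elim (ne refl)
  h0 (suc i) ne = trans (⟦sumTo⟧ M _ t) (Σ≤-0 M _ (λ j _ → trans (⟦pmul⟧ [] (serPow (wSer f) k (N ∸ suc i) (M ∸ j)) t)
                                                             (conv-0ˡ ⟦ [] ⟧ ⟦ serPow (wSer f) k (N ∸ suc i) (M ∸ j) ⟧ t (λ _ → refl))))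


⟦pcomp-∷⟧ : ∀ a p r t → ⟦ pcomp (a ∷ p) r ⟧ t ≡ ⟦ a ∷ [] ⟧ t + conv ⟦ r ⟧ ⟦ pcomp p r ⟧ t
⟦pcomp-∷⟧ a p r t = trans (⟦padd⟧ (a ∷ []) (pmul r (pcomp p r)) t) (cong (⟦ a ∷ [] ⟧ t +_) (⟦pmul⟧ r (pcomp p r) t))

⟦const⟧-+ : ∀ a b t → ⟦ (a + b) ∷ [] ⟧ t ≡ ⟦ a ∷ [] ⟧ t + ⟦ b ∷ [] ⟧ t
⟦const⟧-+ a b zero = refl
⟦const⟧-+ a b (suc t) = refl

⟦const⟧-* : ∀ c a t → ⟦ (c * a) ∷ [] ⟧ t ≡ c * ⟦ a ∷ [] ⟧ t
⟦const⟧-* c a zero = refl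
⟦const⟧-* c a (suc t) = sym (*-zeroʳ c)

⟦const⟧-0 : ∀ t → ⟦ 0ℚ ∷ [] ⟧ t ≡ 0ℚ
⟦const⟧-0 zero = refl
⟦const⟧-0 (suc t) = refl

⟦const⟧-1 : ∀ t → ⟦ 1ℚ ∷ [] ⟧ t ≡ δ0 t
⟦const⟧-1 zero = refl
⟦const⟧-1 (suc t) = refl

pcomp-padd : ∀ p q r t → ⟦ pcomp (padd p q) r ⟧ t ≡ ⟦ pcomp p r ⟧ t + ⟦ pcomp q r ⟧ t
pcomp-padd [] q r t = sym (+-identityˡ _)
pcomp-padd (a ∷ p) [] r t = sym (+-identityʳ _)
pcomp-padd (a ∷ p) (b ∷ q) r t = begin
  ⟦ pcomp ((a + b) ∷ padd p q) r ⟧ t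
    ≡⟨ ⟦pcomp-∷⟧ (a + b) (padd p q) r t ⟩
  ⟦ (a + b) ∷ [] ⟧ t + conv ⟦ r ⟧ ⟦ pcomp (padd p q) r ⟧ t
    ≡⟨ cong₂ _+_ (⟦const⟧-+ a b t) (trans (conv-congʳ ⟦ r ⟧ (pcomp-padd p q r) t) (conv-+ʳ ⟦ r ⟧ ⟦ pcomp p r ⟧ ⟦ pcomp q r ⟧ t)) ⟩
  (⟦ a ∷ [] ⟧ t + ⟦ b ∷ [] ⟧ t) + (conv ⟦ r ⟧ ⟦ pcomp p r ⟧ t + conv ⟦ r ⟧ ⟦ pcomp q r ⟧ t)
    ≡⟨ +-interchange (⟦ a ∷ [] ⟧ t) _ (conv ⟦ r ⟧ ⟦ pcomp p r ⟧ t) _ ⟩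
  (⟦ a ∷ [] ⟧ t + conv ⟦ r ⟧ ⟦ pcomp p r ⟧ t) + (⟦ b ∷ [] ⟧ t + conv ⟦ r ⟧ ⟦ pcomp q r ⟧ t)
    ≡⟨ sym (cong₂ _+_ (⟦pcomp-∷⟧ a p r t) (⟦pcomp-∷⟧ b q r t)) ⟩
  ⟦ pcomp (a ∷ p) r ⟧ t + ⟦ pcomp (b ∷ q) r ⟧ t ∎

pcomp-pscale : ∀ c p r t → ⟦ pcomp (pscale c p) r ⟧ t ≡ c * ⟦ pcomp p r ⟧ t
pcomp-pscale c [] r t = sym (*-zeroʳ c)
pcomp-pscale c (a ∷ p) r t = begin
  ⟦ pcomp ((c * a) ∷ pscale c p) r ⟧ t
    ≡⟨ ⟦pcomp-∷⟧ (c * a) (pscale c p) r t ⟩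
  ⟦ (c * a) ∷ [] ⟧ t + conv ⟦ r ⟧ ⟦ pcomp (pscale c p) r ⟧ t
    ≡⟨ cong₂ _+_ (⟦const⟧-* c a t) (trans (conv-congʳ ⟦ r ⟧ (pcomp-pscale c p r) t) (conv-*ʳ ⟦ r ⟧ c ⟦ pcomp p r ⟧ t)) ⟩
  c * ⟦ a ∷ [] ⟧ t + c * conv ⟦ r ⟧ ⟦ pcomp p r ⟧ t
    ≡⟨ sym (*-distribˡ-+ c _ _) ⟩
  c * (⟦ a ∷ [] ⟧ t + conv ⟦ r ⟧ ⟦ pcomp p r ⟧ t)
    ≡⟨ cong (c *_) (sym (⟦pcomp-∷⟧ a p r t)) ⟩
  c * ⟦ pcomp (a ∷ p) r ⟧ t ∎

pcomp-sumTo : ∀ N (f : ℕ → Poly) r t → ⟦ pcomp (sumTo N f) r ⟧ t ≡ Σ≤ N (λ i → ⟦ pcomp (f i) r ⟧ t)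
pcomp-sumTo zero f r t = refl
pcomp-sumTo (suc N) f r t = trans (pcomp-padd (sumTo N f) (f (suc N)) r t) (cong (_+ ⟦ pcomp (f (suc N)) r ⟧ t) (pcomp-sumTo N f r t))

pcomp-psum : ∀ ps r t → ⟦ pcomp (psum ps) r ⟧ t ≡ Σl ps (λ p → ⟦ pcomp p r ⟧ t)
pcomp-psum [] r t = refl
pcomp-psum (p ∷ ps) r t = trans (pcomp-padd p (psum ps) r t) (cong (⟦ pcomp p r ⟧ t +_) (pcomp-psum ps r t))

pcomp-pmono : ∀ s r t → ⟦ pcomp (pmono s) r ⟧ t ≡ convPow ⟦ r ⟧ s t
pcomp-pmono zero r t = begin
  ⟦ pcomp (1ℚ ∷ []) r ⟧ t ≡⟨ ⟦pcomp-∷⟧ 1ℚ [] r t ⟩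
  ⟦ 1ℚ ∷ [] ⟧ t + conv ⟦ r ⟧ ⟦ [] ⟧ t ≡⟨ cong₂ _+_ (⟦const⟧-1 t) (conv-0ʳ ⟦ r ⟧ _ t (λ _ → refl)) ⟩
  δ0 t + 0ℚ ≡⟨ +-identityʳ _ ⟩
  δ0 t ∎
pcomp-pmono (suc s) r t = begin
  ⟦ pcomp (0ℚ ∷ pmono s) r ⟧ t ≡⟨ ⟦pcomp-∷⟧ 0ℚ (pmono s) r t ⟩
  ⟦ 0ℚ ∷ [] ⟧ t + conv ⟦ r ⟧ ⟦ pcomp (pmono s) r ⟧ t ≡⟨ cong₂ _+_ (⟦const⟧-0 t) (conv-congʳ ⟦ r ⟧ (pcomp-pmono s r) t) ⟩
  0ℚ + convPow ⟦ r ⟧ (suc s) t ≡⟨ +-identityˡ _ ⟩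
  convPow ⟦ r ⟧ (suc s) t ∎


sublists : ∀ {A : Set} → List A → List (List A)
sublists [] = [] ∷ []
sublists (x ∷ xs) = map (x ∷_) (sublists xs) ++ sublists xs

Σsubs-cons : ∀ {A : Set} (x : A) xs (h : List A → ℚ) →
  Σl (sublists (x ∷ xs)) h ≡ Σl (sublists xs) (λ l → h (x ∷ l)) + Σl (sublists xs) h
Σsubs-cons x xs h = trans (Σl-++ (map (x ∷_) (sublists xs)) (sublists xs) h) (cong (_+ Σl (sublists xs) h) (Σl-map (x ∷_) (sublists xs) h))

selectBy : ∀ {A : Set} {n} → (Fin n → Bool) → (Fin n → A) → List A
selectBy {n = zero} q f = []
selectBy {n = suc n} q f with q fz
... | true = f fz ∷ selectBy (λ i → q (fs i)) (λ i → f (fs i))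
... | false = selectBy (λ i → q (fs i)) (λ i → f (fs i))

map-filter-tab : ∀ {A : Set} {n m} (t : Fin n → Fin m) (Q : Fin m → Bool) (f : Fin m → A) →
  map f (filter (λ k → T? (Q k)) (tabulate t)) ≡ selectBy (λ i → Q (t i)) (λ i → f (t i))
map-filter-tab {n = zero} t Q f = refl
map-filter-tab {n = suc n} t Q f with Q (t fz)
... | true = cong (f (t fz) ∷_) (map-filter-tab (λ i → t (fs i)) Q f)
... | false = map-filter-tab (λ i → t (fs i)) Q f

selected≡ : ∀ {A : Set} (xs : List A) S → selected xs S ≡ selectBy (vlookup S) (lookup xs)
selected≡ xs S = map-filter-tab (λ i → i) (vlookup S) (lookup xs)

Σ-allSubsets : ∀ {A : Set} (xs : List A) (h : List A → ℚ) →
  Σl (allSubsets (length xs)) (λ S → h (selected xs S)) ≡ Σl (sublists xs) h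
Σ-allSubsets xs h = trans (Σl-cong (allSubsets (length xs)) (λ S → cong h (selected≡ xs S))) (go xs h)
  where
  go : ∀ {A : Set} (xs : List A) (h : List A → ℚ) →
    Σl (allSubsets (length xs)) (λ S → h (selectBy (vlookup S) (lookup xs))) ≡ Σl (sublists xs) h
  go [] h = refl
  go (x ∷ xs) h = begin
    Σl (map (true ∷_) (allSubsets (length xs)) ++ map (false ∷_) (allSubsets (length xs))) (λ S → h (selectBy (vlookup S) (lookup (x ∷ xs))))
      ≡⟨ Σl-++ (map (true ∷_) (allSubsets (length xs))) _ _ ⟩
    Σl (map (true ∷_) (allSubsets (length xs))) (λ S → h (selectBy (vlookup S) (lookup (x ∷ xs))))
      + Σl (map (false ∷_) (allSubsets (length xs))) (λ S → h (selectBy (vlookup S) (lookup (x ∷ xs))))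
      ≡⟨ cong₂ _+_ (Σl-map (true ∷_) (allSubsets (length xs)) _) (Σl-map (false ∷_) (allSubsets (length xs)) _) ⟩
    Σl (allSubsets (length xs)) (λ S → h (x ∷ selectBy (vlookup S) (lookup xs)))
      + Σl (allSubsets (length xs)) (λ S → h (selectBy (vlookup S) (lookup xs)))
      ≡⟨ cong₂ _+_ (go xs (λ l → h (x ∷ l))) (go xs h) ⟩
    Σl (sublists xs) (λ l → h (x ∷ l)) + Σl (sublists xs) h
      ≡⟨ cong (_+ Σl (sublists xs) h) (sym (Σl-map (x ∷_) (sublists xs) h)) ⟩
    Σl (map (x ∷_) (sublists xs)) h + Σl (sublists xs) h
      ≡⟨ sym (Σl-++ (map (x ∷_) (sublists xs)) (sublists xs) h) ⟩
    Σl (sublists (x ∷ xs)) h ∎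

card-selected : ∀ {A : Set} (xs : List A) S → card S ≡ length (selected xs S)
card-selected xs S = trans (go xs S) (cong length (sym (selected≡ xs S)))
  where
  go : ∀ {A : Set} (xs : List A) S → card S ≡ length (selectBy (vlookup S) (lookup xs))
  go [] [] = refl
  go (x ∷ xs) (true ∷ S) = cong suc (go xs S)
  go (x ∷ xs) (false ∷ S) = go xs S

filter-filter : ∀ {A : Set} (a b : A → Bool) (xs : List A) →
  filter (λ y → T? (a y)) (filter (λ y → T? (b y)) xs) ≡ filter (λ y → T? (b y ∧ a y)) xs
filter-filter a b [] = refl
filter-filter a b (x ∷ xs) with b x
... | false = filter-filter a b xs
... | true with a x
... | true = cong (x ∷_) (filter-filter a b xs)
... | false = filter-filter a b xs

filter-cong : ∀ {A : Set} (a b : A → Bool) (xs : List A) → (∀ x → a x ≡ b x) →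
  filter (λ y → T? (a y)) xs ≡ filter (λ y → T? (b y)) xs
filter-cong a b [] h = refl
filter-cong a b (x ∷ xs) h with a x | b x | h x
... | true | true | _ = cong (x ∷_) (filter-cong a b xs h)
... | false | false | _ = filter-cong a b xs h

Σl-shift : ∀ {A : Set} (xs : List A) (f : A → Seq) t →
  Σl xs (λ x → shift (f x) t) ≡ shift (λ t′ → Σl xs (λ x → f x t′)) t
Σl-shift xs f zero = Σl-0 xs _ (λ _ → refl)
Σl-shift xs f (suc t) = refl

-- The binomial theorem u^k = Σ_{l ⊆ ys} (u − 1)^{|l|} for k = |ys|, read
-- coefficientwise: the coefficient of u^t on the left is [ k ≡ᵇ t ].
binomial-u−1 : ∀ {A : Set} (ys : List A) t →
  Σl (sublists ys) (λ l → convPow ρ (length l) t) ≡ [ length ys ≡ᵇ t ]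
binomial-u−1 [] zero = refl
binomial-u−1 [] (suc t) = refl
binomial-u−1 (y ∷ ys) t = begin
  Σl (sublists (y ∷ ys)) (λ l → P l t)
    ≡⟨ Σsubs-cons y ys _ ⟩
  Σl (sublists ys) (λ l → conv ρ (P l) t) + Σl (sublists ys) (λ l → P l t)
    ≡⟨ cong (_+ Σl (sublists ys) (λ l → P l t)) (Σl-cong (sublists ys) (λ l → ρ-conv (P l) t)) ⟩
  Σl (sublists ys) (λ l → - P l t + shift (P l) t) + Σl (sublists ys) (λ l → P l t)
    ≡⟨ sym (Σl-+ (sublists ys) _ _) ⟩
  Σl (sublists ys) (λ l → (- P l t + shift (P l) t) + P l t)
    ≡⟨ Σl-cong (sublists ys) (λ l → solve 2 (λ a b → (:- a :+ b) :+ a := b) refl (P l t) (shift (P l) t)) ⟩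
  Σl (sublists ys) (λ l → shift (P l) t)
    ≡⟨ Σl-shift (sublists ys) P t ⟩
  shift (λ t′ → Σl (sublists ys) (λ l → P l t′)) t
    ≡⟨ shift-cong (binomial-u−1 ys) t ⟩
  shift (λ t′ → [ length ys ≡ᵇ t′ ]) t
    ≡⟨ shift-monomial (length ys) t ⟩
  [ suc (length ys) ≡ᵇ t ] ∎
  where
  P : List _ → Seq
  P l = convPow ρ (length l)
  shift-cong : ∀ {f g : Seq} → (∀ k → f k ≡ g k) → ∀ k → shift f k ≡ shift g k
  shift-cong h zero = refl
  shift-cong h (suc k) = h k
  shift-monomial : ∀ e k → shift (λ t′ → [ e ≡ᵇ t′ ]) k ≡ [ suc e ≡ᵇ k ]
  shift-monomial e zero = refl
  shift-monomial e (suc k) = refl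

subs-map : ∀ {A B : Set} (f : A → B) (xs : List A) (h : List B → ℚ) →
  Σl (sublists (map f xs)) h ≡ Σl (sublists xs) (λ l → h (map f l))
subs-map f [] h = refl
subs-map f (x ∷ xs) h = begin
  Σl (sublists (f x ∷ map f xs)) h ≡⟨ Σsubs-cons (f x) (map f xs) h ⟩
  Σl (sublists (map f xs)) (λ l → h (f x ∷ l)) + Σl (sublists (map f xs)) h ≡⟨ cong₂ _+_ (subs-map f xs _) (subs-map f xs h) ⟩
  Σl (sublists xs) (λ l → h (f x ∷ map f l)) + Σl (sublists xs) (λ l → h (map f l)) ≡⟨ sym (Σsubs-cons x xs _) ⟩
  Σl (sublists (x ∷ xs)) (λ l → h (map f l)) ∎

subs-filter : ∀ {A : Set} (q : A → Bool) (xs : List A) (h : List A → ℚ) →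
  Σl (sublists (filter (λ y → T? (q y)) xs)) h ≡ Σl (sublists xs) (λ l → [ all q l ] * h l)
subs-filter q [] h = cong (_+ 0ℚ) (sym (*-identityˡ (h [])))
subs-filter q (x ∷ xs) h with q x in eq
... | true = begin
  Σl (sublists (x ∷ filter (λ y → T? (q y)) xs)) h ≡⟨ Σsubs-cons x (filter (λ y → T? (q y)) xs) h ⟩
  Σl (sublists (filter (λ y → T? (q y)) xs)) (λ l → h (x ∷ l)) + Σl (sublists (filter (λ y → T? (q y)) xs)) h
    ≡⟨ cong₂ _+_ (subs-filter q xs _) (subs-filter q xs h) ⟩
  Σl (sublists xs) (λ l → [ all q l ] * h (x ∷ l)) + Σl (sublists xs) (λ l → [ all q l ] * h l)
    ≡⟨ cong (_+ Σl (sublists xs) (λ l → [ all q l ] * h l)) (Σl-cong (sublists xs) (λ l → cong (λ b → [ b ∧ all q l ] * h (x ∷ l)) (sym eq))) ⟩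
  Σl (sublists xs) (λ l → [ q x ∧ all q l ] * h (x ∷ l)) + Σl (sublists xs) (λ l → [ all q l ] * h l) ≡⟨ sym (Σsubs-cons x xs _) ⟩
  Σl (sublists (x ∷ xs)) (λ l → [ all q l ] * h l) ∎
... | false = begin
  Σl (sublists (filter (λ y → T? (q y)) xs)) h ≡⟨ subs-filter q xs h ⟩
  Σl (sublists xs) (λ l → [ all q l ] * h l) ≡⟨ sym (+-identityˡ _) ⟩
  0ℚ + Σl (sublists xs) (λ l → [ all q l ] * h l)
    ≡⟨ cong (_+ Σl (sublists xs) (λ l → [ all q l ] * h l)) (sym (Σl-0 (sublists xs) _ (λ l → *-zeroˡ (h (x ∷ l))))) ⟩
  Σl (sublists xs) (λ l → [ false ] * h (x ∷ l)) + Σl (sublists xs) (λ l → [ all q l ] * h l)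
    ≡⟨ cong (_+ Σl (sublists xs) (λ l → [ all q l ] * h l)) (Σl-cong (sublists xs) (λ l → cong (λ b → [ b ∧ all q l ] * h (x ∷ l)) (sym eq))) ⟩
  Σl (sublists xs) (λ l → [ q x ∧ all q l ] * h (x ∷ l)) + Σl (sublists xs) (λ l → [ all q l ] * h l) ≡⟨ sym (Σsubs-cons x xs _) ⟩
  Σl (sublists (x ∷ xs)) (λ l → [ all q l ] * h l) ∎

count-indicator-expansion : ∀ {A : Set} (a : A → Bool) (xs : List A) t →
  [ length (filter (λ y → T? (a y)) xs) ≡ᵇ t ] ≡ Σl (sublists xs) (λ l → convPow ρ (length l) t * [ all a l ])
count-indicator-expansion a xs t = begin
  [ length (filter (λ y → T? (a y)) xs) ≡ᵇ t ]
    ≡⟨ sym (binomial-u−1 (filter (λ y → T? (a y)) xs) t) ⟩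
  Σl (sublists (filter (λ y → T? (a y)) xs)) (λ l → convPow ρ (length l) t)
    ≡⟨ subs-filter a xs _ ⟩
  Σl (sublists xs) (λ l → [ all a l ] * convPow ρ (length l) t)
    ≡⟨ Σl-cong (sublists xs) (λ l → *-comm [ all a l ] _) ⟩
  Σl (sublists xs) (λ l → convPow ρ (length l) t * [ all a l ]) ∎

subs-perm : ∀ {A : Set} {xs ys : List A} → xs ↭ ys → (h : List A → ℚ) →
  (∀ {l l′} → l ↭ l′ → h l ≡ h l′) → Σl (sublists xs) h ≡ Σl (sublists ys) h
subs-perm Perm.refl h inv = refl
subs-perm {xs = x ∷ xs} {x ∷ ys} (Perm.prep x p) h inv = begin
  Σl (sublists (x ∷ xs)) h ≡⟨ Σsubs-cons x xs h ⟩
  Σl (sublists xs) (λ l → h (x ∷ l)) + Σl (sublists xs) h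
    ≡⟨ cong₂ _+_ (subs-perm p (λ l → h (x ∷ l)) (λ q → inv (Perm.prep x q))) (subs-perm p h inv) ⟩
  Σl (sublists ys) (λ l → h (x ∷ l)) + Σl (sublists ys) h ≡⟨ sym (Σsubs-cons x ys h) ⟩
  Σl (sublists (x ∷ ys)) h ∎
subs-perm {xs = x ∷ y ∷ xs} {y ∷ x ∷ ys} (Perm.swap x y p) h inv = begin
  Σl (sublists (x ∷ y ∷ xs)) h ≡⟨ Σsubs-cons x (y ∷ xs) h ⟩
  Σl (sublists (y ∷ xs)) (λ l → h (x ∷ l)) + Σl (sublists (y ∷ xs)) h ≡⟨ cong₂ _+_ (Σsubs-cons y xs _) (Σsubs-cons y xs h) ⟩
  (Σl (sublists xs) (λ l → h (x ∷ y ∷ l)) + Σl (sublists xs) (λ l → h (x ∷ l))) + (Σl (sublists xs) (λ l → h (y ∷ l)) + Σl (sublists xs) h)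
    ≡⟨ cong₂ _+_ (cong₂ _+_ (subs-perm p (λ l → h (x ∷ y ∷ l)) (λ q → inv (Perm.prep x (Perm.prep y q))))
                             (subs-perm p (λ l → h (x ∷ l)) (λ q → inv (Perm.prep x q))))
                 (cong₂ _+_ (subs-perm p (λ l → h (y ∷ l)) (λ q → inv (Perm.prep y q))) (subs-perm p h inv)) ⟩
  (Σl (sublists ys) (λ l → h (x ∷ y ∷ l)) + Σl (sublists ys) (λ l → h (x ∷ l))) + (Σl (sublists ys) (λ l → h (y ∷ l)) + Σl (sublists ys) h)
    ≡⟨ cong (λ z → (z + Σl (sublists ys) (λ l → h (x ∷ l))) + (Σl (sublists ys) (λ l → h (y ∷ l)) + Σl (sublists ys) h))
            (Σl-cong (sublists ys) (λ l → inv (Perm.swap x y Perm.refl))) ⟩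
  (Σl (sublists ys) (λ l → h (y ∷ x ∷ l)) + Σl (sublists ys) (λ l → h (x ∷ l))) + (Σl (sublists ys) (λ l → h (y ∷ l)) + Σl (sublists ys) h)
    ≡⟨ +-interchange
         (Σl (sublists ys) (λ l → h (y ∷ x ∷ l))) (Σl (sublists ys) (λ l → h (x ∷ l))) (Σl (sublists ys) (λ l → h (y ∷ l))) (Σl (sublists ys) h) ⟩
  (Σl (sublists ys) (λ l → h (y ∷ x ∷ l)) + Σl (sublists ys) (λ l → h (y ∷ l))) + (Σl (sublists ys) (λ l → h (x ∷ l)) + Σl (sublists ys) h)
    ≡⟨ sym (cong₂ _+_ (Σsubs-cons x ys _) (Σsubs-cons x ys h)) ⟩
  Σl (sublists (x ∷ ys)) (λ l → h (y ∷ l)) + Σl (sublists (x ∷ ys)) h ≡⟨ sym (Σsubs-cons y (x ∷ ys) h) ⟩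
  Σl (sublists (y ∷ x ∷ ys)) h ∎
subs-perm (Perm.trans p q) h inv = trans (subs-perm p h inv) (subs-perm q h inv)

eqB : Bool → Bool → Bool
eqB true b = b
eqB false b = not b

eqV : ∀ {n} → Vec Bool n → Vec Bool n → Bool
eqV [] [] = true
eqV (a ∷ u) (b ∷ v) = eqB a b ∧ eqV u v

Σ-unique : ∀ {n} (X : Vec Bool n) (f : Vec Bool n → ℚ) →
  Σl (allSubsets n) (λ V → [ eqV X V ] * f V) ≡ f X
Σ-unique [] f = trans (+-identityʳ _) (*-identityˡ (f []))
Σ-unique {suc n} (true ∷ X) f = begin
  Σl (map (true ∷_) (allSubsets n) ++ map (false ∷_) (allSubsets n)) (λ V → [ eqV (true ∷ X) V ] * f V)
    ≡⟨ Σl-++ (map (true ∷_) (allSubsets n)) _ _ ⟩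
  _ ≡⟨ cong₂ _+_ (Σl-map (true ∷_) (allSubsets n) _) (Σl-map (false ∷_) (allSubsets n) _) ⟩
  Σl (allSubsets n) (λ V → [ eqV X V ] * f (true ∷ V)) + Σl (allSubsets n) (λ V → [ false ] * f (false ∷ V))
    ≡⟨ cong₂ _+_ (Σ-unique X (λ V → f (true ∷ V))) (Σl-0 (allSubsets n) _ (λ V → *-zeroˡ (f (false ∷ V)))) ⟩
  f (true ∷ X) + 0ℚ ≡⟨ +-identityʳ _ ⟩
  f (true ∷ X) ∎
Σ-unique {suc n} (false ∷ X) f = begin
  Σl (map (true ∷_) (allSubsets n) ++ map (false ∷_) (allSubsets n)) (λ V → [ eqV (false ∷ X) V ] * f V)
    ≡⟨ Σl-++ (map (true ∷_) (allSubsets n)) _ _ ⟩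
  _ ≡⟨ cong₂ _+_ (Σl-map (true ∷_) (allSubsets n) _) (Σl-map (false ∷_) (allSubsets n) _) ⟩
  Σl (allSubsets n) (λ V → [ false ] * f (true ∷ V)) + Σl (allSubsets n) (λ V → [ eqV X V ] * f (false ∷ V))
    ≡⟨ cong₂ _+_ (Σl-0 (allSubsets n) _ (λ V → *-zeroˡ (f (true ∷ V)))) (Σ-unique X (λ V → f (false ∷ V))) ⟩
  0ℚ + f (false ∷ X) ≡⟨ +-identityˡ _ ⟩
  f (false ∷ X) ∎

-- Summing a function of the cardinality over all subsets of Fin n:
-- Σ_{V ⊆ [n]} f |V| = Σ_{i ≤ n} C(n, i) f i (Pascal's rule).
Σ-card : ∀ n (f : ℕ → ℚ) → Σl (allSubsets n) (λ V → f (card V)) ≡ Σ≤ n (λ i → ℕ→ℚ (n C i) * f i)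
Σ-card zero f = trans (+-identityʳ _) (sym (*-identityˡ (f 0)))
Σ-card (suc n) f = begin
  Σl (map (true ∷_) (allSubsets n) ++ map (false ∷_) (allSubsets n)) (λ V → f (card V))
    ≡⟨ Σl-++ (map (true ∷_) (allSubsets n)) _ _ ⟩
  _ ≡⟨ cong₂ _+_ (Σl-map (true ∷_) (allSubsets n) _) (Σl-map (false ∷_) (allSubsets n) _) ⟩
  Σl (allSubsets n) (λ V → f (suc (card V))) + Σl (allSubsets n) (λ V → f (card V))
    ≡⟨ cong₂ _+_ (Σ-card n (λ i → f (suc i))) (Σ-card n f) ⟩
  Σ≤ n (λ i → ℕ→ℚ (n C i) * f (suc i)) + Σ≤ n (λ i → ℕ→ℚ (n C i) * f i)
    ≡⟨ cong (Σ≤ n (λ i → ℕ→ℚ (n C i) * f (suc i)) +_) reindex ⟩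
  Σ≤ n (λ i → ℕ→ℚ (n C i) * f (suc i)) + (f 0 + Σ≤ n (λ i → ℕ→ℚ (n C suc i) * f (suc i)))
    ≡⟨ solve 3 (λ a b c → a :+ (b :+ c) := b :+ (a :+ c)) refl (Σ≤ n (λ i → ℕ→ℚ (n C i) * f (suc i))) (f 0) _ ⟩
  f 0 + (Σ≤ n (λ i → ℕ→ℚ (n C i) * f (suc i)) + Σ≤ n (λ i → ℕ→ℚ (n C suc i) * f (suc i)))
    ≡⟨ cong (f 0 +_) (sym (Σ≤-+ n _ _)) ⟩
  f 0 + Σ≤ n (λ i → ℕ→ℚ (n C i) * f (suc i) + ℕ→ℚ (n C suc i) * f (suc i))
    ≡⟨ cong₂ _+_ (sym (*-identityˡ (f 0))) (Σ≤-cong n (λ i _ → trans (sym (*-distribʳ-+ (f (suc i)) (ℕ→ℚ (n C i)) (ℕ→ℚ (n C suc i))))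
          (cong (_* f (suc i)) (trans (sym (ℕ→ℚ-+ (n C i) (n C suc i))) (cong ℕ→ℚ (nCk+nC[k+1]≡[n+1]C[k+1] n i)))))) ⟩
  1ℚ * f 0 + Σ≤ n (λ i → ℕ→ℚ (suc n C suc i) * f (suc i))
    ≡⟨ sym (Σ≤-suc n (λ i → ℕ→ℚ (suc n C i) * f i)) ⟩
  Σ≤ (suc n) (λ i → ℕ→ℚ (suc n C i) * f i) ∎
  where
  -- splitting off i = 0, using C(n, n+1) = 0 to extend the sum by one term
  reindex : Σ≤ n (λ i → ℕ→ℚ (n C i) * f i) ≡ f 0 + Σ≤ n (λ i → ℕ→ℚ (n C suc i) * f (suc i))
  reindex = begin
    Σ≤ n (λ i → ℕ→ℚ (n C i) * f i) ≡⟨ sym (+-identityʳ _) ⟩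
    Σ≤ n (λ i → ℕ→ℚ (n C i) * f i) + 0ℚ
      ≡⟨ cong (Σ≤ n (λ i → ℕ→ℚ (n C i) * f i) +_) (sym (trans (cong (λ z → ℕ→ℚ z * f (suc n)) (k>n⇒nCk≡0 (ℕP.n<1+n n))) (*-zeroˡ (f (suc n))))) ⟩
    Σ≤ (suc n) (λ i → ℕ→ℚ (n C i) * f i) ≡⟨ Σ≤-suc n _ ⟩
    ℕ→ℚ (n C 0) * f 0 + Σ≤ n (λ i → ℕ→ℚ (n C suc i) * f (suc i)) ≡⟨ cong (_+ Σ≤ n (λ i → ℕ→ℚ (n C suc i) * f (suc i))) (*-identityˡ (f 0)) ⟩
    f 0 + Σ≤ n (λ i → ℕ→ℚ (n C suc i) * f (suc i)) ∎


false≢true : false ≢ true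
false≢true ()

notTrue : ∀ {b} → ¬ (b ≡ true) → b ≡ false
notTrue {true} h = ⊥-elim (h refl)
notTrue {false} h = refl

∧-true : ∀ {a b} → a ∧ b ≡ true → a ≡ true × b ≡ true
∧-true {true} {true} _ = refl , refl

∨-true : ∀ {a b} → a ∨ b ≡ true → (a ≡ true) ⊎ (b ≡ true)
∨-true {true} _ = inj₁ refl
∨-true {false} {true} _ = inj₂ refl

T→≡ : ∀ {b} → T b → b ≡ true
T→≡ {true} _ = refl

≡→T : ∀ {b} → b ≡ true → T b
≡→T refl = tt

bool-ext : ∀ {a b : Bool} → (a ≡ true → b ≡ true) → (b ≡ true → a ≡ true) → a ≡ b
bool-ext {true} {true} f g = refl
bool-ext {true} {false} f g = sym (f refl)
bool-ext {false} {true} f g = g refl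
bool-ext {false} {false} f g = refl

∧-rot : ∀ a b c → (a ∧ b) ∧ c ≡ (a ∧ c) ∧ b
∧-rot true true true = refl
∧-rot true true false = refl
∧-rot true false true = refl
∧-rot true false false = refl
∧-rot false b c = refl

swap∨ : ∀ a b c → a ∨ (b ∨ c) ≡ b ∨ (a ∨ c)
swap∨ true true c = refl
swap∨ true false c = refl
swap∨ false b c = refl

dec-true⁻ : ∀ {P : Set} (d : Dec P) → does d ≡ true → P
dec-true⁻ (yes p) _ = p

dec-true⁺ : ∀ {P : Set} (d : Dec P) → P → does d ≡ true
dec-true⁺ (yes p) _ = refl
dec-true⁺ (no ¬p) p = ⊥-elim (¬p p)

anyF : ∀ n → (Fin n → Bool) → Bool
anyF zero f = false
anyF (suc n) f = f fz ∨ anyF n (λ i → f (fs i))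

allF : ∀ n → (Fin n → Bool) → Bool
allF zero f = true
allF (suc n) f = f fz ∧ allF n (λ i → f (fs i))

anyF-cong : ∀ n {f g : Fin n → Bool} → (∀ j → f j ≡ g j) → anyF n f ≡ anyF n g
anyF-cong zero h = refl
anyF-cong (suc n) h = cong₂ _∨_ (h fz) (anyF-cong n (λ j → h (fs j)))

allF-cong : ∀ n {f g : Fin n → Bool} → (∀ j → f j ≡ g j) → allF n f ≡ allF n g
allF-cong zero h = refl
allF-cong (suc n) h = cong₂ _∧_ (h fz) (allF-cong n (λ j → h (fs j)))

anyF-false : ∀ n (g : Fin n → Bool) → (∀ j → g j ≡ false) → anyF n g ≡ false
anyF-false zero g h = refl
anyF-false (suc n) g h = cong₂ _∨_ (h fz) (anyF-false n _ (λ j → h (fs j)))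

anyF-single : ∀ n (g : Fin n → Bool) k → (∀ j → j ≢ k → g j ≡ false) → anyF n g ≡ g k
anyF-single (suc n) g fz h = trans (cong (g fz ∨_) (anyF-false n _ (λ j → h (fs j) (λ ())))) (∨-identityʳ (g fz))
anyF-single (suc n) g (fs k) h = trans (cong (_∨ anyF n (λ i → g (fs i))) (h fz (λ ())))
  (anyF-single n (λ i → g (fs i)) k (λ j ne → h (fs j) (λ e → ne (FP.suc-injective e))))

all-tab : ∀ {n} (f : Fin n → Bool) → all f (allFin n) ≡ allF n f
all-tab f = go _ (λ i → i) f
  where
  go : ∀ n {m} (t : Fin n → Fin m) (f : Fin m → Bool) → all f (tabulate t) ≡ allF n (λ i → f (t i))
  go zero t f = refl
  go (suc n) t f = cong (f (t fz) ∧_) (go n (λ i → t (fs i)) f)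

any-zip : ∀ {A B : Set} (xs : List A) (v : Vec B (length xs)) (f : A × B → Bool) →
  any f (zip xs (toList v)) ≡ anyF (length xs) (λ j → f (lookup xs j , vlookup v j))
any-zip [] [] f = refl
any-zip (x ∷ xs) (b ∷ v) f = cong (f (x , b) ∨_) (any-zip xs v f)

any-true⁻ : ∀ {A : Set} (f : A → Bool) (xs : List A) → any f xs ≡ true → ∃[ x ] x ∈ xs × f x ≡ true
any-true⁻ f (y ∷ xs) e with f y in ey
... | true = y , here refl , ey
... | false with any-true⁻ f xs e
... | x , m , fx = x , there m , fx

any-true⁺ : ∀ {A : Set} (f : A → Bool) {xs : List A} {x} → x ∈ xs → f x ≡ true → any f xs ≡ true
any-true⁺ f (here refl) e rewrite e = refl
any-true⁺ f {y ∷ xs} (there m) e rewrite any-true⁺ f m e = ∨-zeroʳ (f y)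

any-cong : ∀ {A : Set} {f g : A → Bool} (xs : List A) → (∀ x → f x ≡ g x) → any f xs ≡ any g xs
any-cong [] h = refl
any-cong (x ∷ xs) h = cong₂ _∨_ (h x) (any-cong xs h)

all-cong : ∀ {A : Set} {f g : A → Bool} (xs : List A) → (∀ x → f x ≡ g x) → all f xs ≡ all g xs
all-cong [] h = refl
all-cong (x ∷ xs) h = cong₂ _∧_ (h x) (all-cong xs h)

any-map : ∀ {A B : Set} (f : B → Bool) (g : A → B) (xs : List A) → any f (map g xs) ≡ any (λ x → f (g x)) xs
any-map f g [] = refl
any-map f g (x ∷ xs) = cong (f (g x) ∨_) (any-map f g xs)

any-false : ∀ {A : Set} (f : A → Bool) (xs : List A) → (∀ x → f x ≡ false) → any f xs ≡ false
any-false f [] h = refl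
any-false f (x ∷ xs) h rewrite h x = any-false f xs h

any-perm : ∀ {A : Set} (f : A → Bool) {xs ys : List A} → xs ↭ ys → any f xs ≡ any f ys
any-perm f Perm.refl = refl
any-perm f (Perm.prep x p) = cong (f x ∨_) (any-perm f p)
any-perm f (Perm.swap x y p) = trans (cong (λ z → f x ∨ (f y ∨ z)) (any-perm f p)) (swap∨ (f x) (f y) _)
any-perm f (Perm.trans p q) = trans (any-perm f p) (any-perm f q)

all-true⁻ : ∀ {A : Set} (f : A → Bool) (xs : List A) → all f xs ≡ true → ∀ {x} → x ∈ xs → f x ≡ true
all-true⁻ f (y ∷ xs) e (here refl) = proj₁ (∧-true e)
all-true⁻ f (y ∷ xs) e (there m) = all-true⁻ f xs (proj₂ (∧-true e)) m

all-true⁺ : ∀ {A : Set} (f : A → Bool) (xs : List A) → (∀ x → f x ≡ true) → all f xs ≡ true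
all-true⁺ f [] h = refl
all-true⁺ f (y ∷ xs) h rewrite h y = all-true⁺ f xs h

all-true⁺∈ : ∀ {A : Set} (f : A → Bool) (xs : List A) → (∀ x → x ∈ xs → f x ≡ true) → all f xs ≡ true
all-true⁺∈ f [] h = refl
all-true⁺∈ f (y ∷ xs) h rewrite h y (here refl) = all-true⁺∈ f xs (λ x m → h x (there m))

=ᶠ-refl : ∀ {n} (a : Fin n) → (a =ᶠ a) ≡ true
=ᶠ-refl a with a Fin.≟ a
... | yes _ = refl
... | no ne = ⊥-elim (ne refl)

=ᶠ-true : ∀ {n} {a b : Fin n} → (a =ᶠ b) ≡ true → a ≡ b
=ᶠ-true {a = a} {b} h with a Fin.≟ b
... | yes e = e
... | no _ = ⊥-elim (false≢true h)

ind : Bool → ℕ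
ind true = 1
ind false = 0

ΣFn : ∀ n → (Fin n → ℕ) → ℕ
ΣFn zero h = 0
ΣFn (suc n) h = h fz ℕ.+ ΣFn n (λ i → h (fs i))

ΣL : ∀ {A : Set} → List A → (A → ℕ) → ℕ
ΣL [] h = 0
ΣL (x ∷ xs) h = h x ℕ.+ ΣL xs h

ΣFn-cong : ∀ n {f g : Fin n → ℕ} → (∀ i → f i ≡ g i) → ΣFn n f ≡ ΣFn n g
ΣFn-cong zero h = refl
ΣFn-cong (suc n) h = cong₂ ℕ._+_ (h fz) (ΣFn-cong n (λ i → h (fs i)))

ΣL-cong : ∀ {A : Set} (xs : List A) {f g : A → ℕ} → (∀ x → f x ≡ g x) → ΣL xs f ≡ ΣL xs g
ΣL-cong [] h = refl
ΣL-cong (x ∷ xs) h = cong₂ ℕ._+_ (h x) (ΣL-cong xs h)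

ΣFn-0 : ∀ n (f : Fin n → ℕ) → (∀ i → f i ≡ 0) → ΣFn n f ≡ 0
ΣFn-0 zero f h = refl
ΣFn-0 (suc n) f h = cong₂ ℕ._+_ (h fz) (ΣFn-0 n _ (λ i → h (fs i)))

ΣFn-1 : ∀ k → ΣFn k (λ _ → 1) ≡ k
ΣFn-1 zero = refl
ΣFn-1 (suc k) = cong suc (ΣFn-1 k)

ΣFn-lookup : ∀ {A : Set} (xs : List A) (h : A → ℕ) → ΣFn (length xs) (λ k → h (lookup xs k)) ≡ ΣL xs h
ΣFn-lookup [] h = refl
ΣFn-lookup (x ∷ xs) h = cong (h x ℕ.+_) (ΣFn-lookup xs h)

ΣL-filter : ∀ {A : Set} {P : Pred A lzero} (P? : Decidable P) (xs : List A) (h : A → ℕ) →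
  ΣL (filter P? xs) h ≡ ΣL xs (λ p → if does (P? p) then h p else 0)
ΣL-filter P? [] h = refl
ΣL-filter P? (x ∷ xs) h with does (P? x)
... | true = cong (h x ℕ.+_) (ΣL-filter P? xs h)
... | false = ΣL-filter P? xs h

ΣL-++ : ∀ {A : Set} (xs ys : List A) (h : A → ℕ) → ΣL (xs ++ ys) h ≡ ΣL xs h ℕ.+ ΣL ys h
ΣL-++ [] ys h = refl
ΣL-++ (x ∷ xs) ys h = trans (cong (h x ℕ.+_) (ΣL-++ xs ys h)) (sym (ℕP.+-assoc (h x) _ _))

ΣL-map : ∀ {A B : Set} (g : A → B) (xs : List A) (h : B → ℕ) → ΣL (map g xs) h ≡ ΣL xs (λ x → h (g x))
ΣL-map g [] h = refl
ΣL-map g (x ∷ xs) h = cong (h (g x) ℕ.+_) (ΣL-map g xs h)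

ΣL-cart : ∀ {A B : Set} (xs : List A) (ys : List B) (h : A × B → ℕ) →
  ΣL (cartesianProduct xs ys) h ≡ ΣL xs (λ x → ΣL ys (λ y → h (x , y)))
ΣL-cart [] ys h = refl
ΣL-cart (x ∷ xs) ys h = trans (ΣL-++ (map (x ,_) ys) _ h) (cong₂ ℕ._+_ (ΣL-map (x ,_) ys h) (ΣL-cart xs ys h))

ΣL-allFin : ∀ n (h : Fin n → ℕ) → ΣL (allFin n) h ≡ ΣFn n h
ΣL-allFin n h = go n (λ i → i) h
  where
  go : ∀ n {m} (t : Fin n → Fin m) (h : Fin m → ℕ) → ΣL (tabulate t) h ≡ ΣFn n (λ i → h (t i))
  go zero t h = refl
  go (suc n) t h = cong (h (t fz) ℕ.+_) (go n (λ i → t (fs i)) h)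

ifz : ∀ (b : Bool) → (if b then 0 else 0) ≡ 0
ifz true = refl
ifz false = refl

card-tab : ∀ K (h : Fin K → Bool) → card (vtabulate h) ≡ ΣFn K (λ k → ind (h k))
card-tab zero h = refl
card-tab (suc K) h with h fz
... | true = cong suc (card-tab K (λ i → h (fs i)))
... | false = card-tab K (λ i → h (fs i))


ordered? : ∀ {n} (p : Fin n × Fin n) → Dec (proj₁ p Fin.< proj₂ p)
ordered? p = proj₁ p <? proj₂ p

pairAt : ∀ n → Fin (npairs n) → Fin n × Fin n
pairAt n k = lookup (pairs n) k

pairAt-ordered : ∀ n k → proj₁ (pairAt n k) Fin.< proj₂ (pairAt n k)
pairAt-ordered n k = proj₂ (∈-filter⁻ ordered? {xs = cartesianProduct (allFin n) (allFin n)} (∈-lookup k))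

pairAt-surj : ∀ n (a b : Fin n) → a Fin.< b → ∃[ k ] pairAt n k ≡ (a , b)
pairAt-surj n a b lt = Any.index m , sym (lookup-index m)
  where
  m : (a , b) ∈ pairs n
  m = ∈-filter⁺ ordered? (∈-cartesianProduct⁺ (∈-allFin a) (∈-allFin b)) lt

pairs-unique : ∀ n → Unique (pairs n)
pairs-unique n = UP.filter⁺ ordered? (UP.cartesianProduct⁺ (UP.allFin⁺ n) (UP.allFin⁺ n))

lookup-inj : ∀ {A : Set} {xs : List A} → Unique xs → ∀ i j → lookup xs i ≡ lookup xs j → i ≡ j
lookup-inj (px ∷ u) fz fz e = refl
lookup-inj (px ∷ u) fz (fs j) e = ⊥-elim (All.lookup px (∈-lookup j) e)
lookup-inj (px ∷ u) (fs i) fz e = ⊥-elim (All.lookup px (∈-lookup i) (sym e))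
lookup-inj (px ∷ u) (fs i) (fs j) e = cong fs (lookup-inj u i j e)

pairAt-inj : ∀ n i j → pairAt n i ≡ pairAt n j → i ≡ j
pairAt-inj n = lookup-inj (pairs-unique n)

joins : ∀ {n} → Fin n → Fin n → Fin n × Fin n → Bool
joins a b p = (proj₁ p =ᶠ a ∧ proj₂ p =ᶠ b) ∨ (proj₁ p =ᶠ b ∧ proj₂ p =ᶠ a)

adj-anyF : ∀ n (E : EdgeSet n) a b → adj E a b ≡ anyF (npairs n) (λ j → vlookup E j ∧ joins a b (pairAt n j))
adj-anyF n E a b = any-zip (pairs n) E (λ pe → proj₂ pe ∧ joins a b (proj₁ pe))

joins-inj : ∀ n j k → joins (proj₁ (pairAt n k)) (proj₂ (pairAt n k)) (pairAt n j) ≡ true → j ≡ k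
joins-inj n j k h with ∨-true h
... | inj₁ h1 = let (e1 , e2) = ∧-true h1 in pairAt-inj n j k (cong₂ _,_ (=ᶠ-true e1) (=ᶠ-true e2))
... | inj₂ h2 = let (e1 , e2) = ∧-true h2 in
  ⊥-elim (ℕP.<-asym (pairAt-ordered n k) (subst₂ Fin._<_ (=ᶠ-true e1) (=ᶠ-true e2) (pairAt-ordered n j)))

joins-self : ∀ {n} (a b : Fin n) → joins a b (a , b) ≡ true
joins-self a b rewrite =ᶠ-refl a | =ᶠ-refl b = refl

adj-pairAt : ∀ n (E : EdgeSet n) k → adj E (proj₁ (pairAt n k)) (proj₂ (pairAt n k)) ≡ vlookup E k
adj-pairAt n E k = trans (adj-anyF n E _ _) (trans (anyF-single (npairs n) _ k h)
  (trans (cong (vlookup E k ∧_) (joins-self (proj₁ (pairAt n k)) (proj₂ (pairAt n k)))) (∧-identityʳ _)))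
  where
  h : ∀ j → j ≢ k → vlookup E j ∧ joins (proj₁ (pairAt n k)) (proj₂ (pairAt n k)) (pairAt n j) ≡ false
  h j ne = trans (cong (vlookup E j ∧_) (notTrue (λ m → ne (joins-inj n j k m)))) (∧-zeroʳ _)

adj-diag : ∀ n (E : EdgeSet n) a → adj E a a ≡ false
adj-diag n E a = trans (adj-anyF n E a a) (anyF-false (npairs n) _ h)
  where
  h : ∀ j → vlookup E j ∧ joins a a (pairAt n j) ≡ false
  h j = trans (cong (vlookup E j ∧_) (notTrue m)) (∧-zeroʳ _)
    where
    m : ¬ (joins a a (pairAt n j) ≡ true)
    m e with ∨-true e
    ... | inj₁ h1 = let (e1 , e2) = ∧-true h1 in ℕP.<-irrefl (cong toℕ (trans (=ᶠ-true e1) (sym (=ᶠ-true e2)))) (pairAt-ordered n j)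
    ... | inj₂ h1 = let (e1 , e2) = ∧-true h1 in ℕP.<-irrefl (cong toℕ (trans (=ᶠ-true e1) (sym (=ᶠ-true e2)))) (pairAt-ordered n j)

adj-sym : ∀ n (E : EdgeSet n) a b → adj E a b ≡ adj E b a
adj-sym n E a b = trans (adj-anyF n E a b) (trans (anyF-cong (npairs n) swap-ends) (sym (adj-anyF n E b a)))
  where
  swap-ends : ∀ j → vlookup E j ∧ joins a b (pairAt n j) ≡ vlookup E j ∧ joins b a (pairAt n j)
  swap-ends j = cong (vlookup E j ∧_) (∨-comm (proj₁ (pairAt n j) =ᶠ a ∧ proj₂ (pairAt n j) =ᶠ b) _)

fromAdj : ∀ {n} → (Fin n → Fin n → Bool) → EdgeSet n
fromAdj {n} f = vtabulate (λ k → f (proj₁ (pairAt n k)) (proj₂ (pairAt n k)))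

lookup-fromAdj : ∀ {n} (f : Fin n → Fin n → Bool) k → vlookup (fromAdj f) k ≡ f (proj₁ (pairAt n k)) (proj₂ (pairAt n k))
lookup-fromAdj {n} f k = VP.lookup∘tabulate (λ k → f (proj₁ (pairAt n k)) (proj₂ (pairAt n k))) k

adj-fromAdj : ∀ {n} (f : Fin n → Fin n → Bool) a b → a Fin.< b → adj (fromAdj f) a b ≡ f a b
adj-fromAdj {n} f a b lt with pairAt-surj n a b lt
... | k , e = begin
  adj (fromAdj f) a b ≡⟨ cong (λ p → adj (fromAdj f) (proj₁ p) (proj₂ p)) (sym e) ⟩
  adj (fromAdj f) (proj₁ (pairAt n k)) (proj₂ (pairAt n k)) ≡⟨ adj-pairAt n (fromAdj f) k ⟩
  vlookup (fromAdj f) k ≡⟨ lookup-fromAdj f k ⟩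
  f (proj₁ (pairAt n k)) (proj₂ (pairAt n k)) ≡⟨ cong (λ p → f (proj₁ p) (proj₂ p)) e ⟩
  f a b ∎

edge-ext : ∀ n (E E′ : EdgeSet n) → (∀ a b → a Fin.< b → adj E a b ≡ adj E′ a b) → E ≡ E′
edge-ext n E E′ h = begin
  E ≡⟨ sym (VP.tabulate∘lookup E) ⟩
  vtabulate (vlookup E) ≡⟨ VP.tabulate-cong (λ k → trans (sym (adj-pairAt n E k)) (trans (h _ _ (pairAt-ordered n k)) (adj-pairAt n E′ k))) ⟩
  vtabulate (vlookup E′) ≡⟨ VP.tabulate∘lookup E′ ⟩
  E′ ∎

fromAdj-adj : ∀ n (E : EdgeSet n) → fromAdj {n} (adj E) ≡ E
fromAdj-adj n E = trans (VP.tabulate-cong {f = λ k → adj E (proj₁ (pairAt n k)) (proj₂ (pairAt n k))} (adj-pairAt n E)) (VP.tabulate∘lookup E)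

Σ-pairs : ∀ n (f : Fin n → Fin n → Bool) →
  ΣFn (npairs n) (λ k → ind (f (proj₁ (pairAt n k)) (proj₂ (pairAt n k)))) ≡
  ΣFn n (λ a → ΣFn n (λ b → if does (a <? b) then ind (f a b) else 0))
Σ-pairs n f = begin
  ΣFn (npairs n) (λ k → ind (f (proj₁ (pairAt n k)) (proj₂ (pairAt n k)))) ≡⟨ ΣFn-lookup (pairs n) (λ p → ind (f (proj₁ p) (proj₂ p))) ⟩
  ΣL (pairs n) (λ p → ind (f (proj₁ p) (proj₂ p))) ≡⟨ ΣL-filter ordered? (cartesianProduct (allFin n) (allFin n)) _ ⟩
  ΣL (cartesianProduct (allFin n) (allFin n)) (λ p → if does (ordered? p) then ind (f (proj₁ p) (proj₂ p)) else 0)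
    ≡⟨ ΣL-cart (allFin n) (allFin n) _ ⟩
  ΣL (allFin n) (λ a → ΣL (allFin n) (λ b → if does (a <? b) then ind (f a b) else 0))
    ≡⟨ trans (ΣL-cong (allFin n) (λ a → ΣL-allFin n _)) (ΣL-allFin n _) ⟩
  ΣFn n (λ a → ΣFn n (λ b → if does (a <? b) then ind (f a b) else 0)) ∎

orderedPairs : ℕ → ℕ
orderedPairs n = ΣFn n (λ a → ΣFn n (λ b → if does (a <? b) then ind true else 0))

-- Counting the pairs a < b in Fin (1 + n) by whether a = 0.
orderedPairs-suc : ∀ n → orderedPairs (suc n) ≡ n ℕ.+ orderedPairs n
orderedPairs-suc n = cong₂ ℕ._+_ (ΣFn-1 n) refl

orderedPairs≡C2 : ∀ n → orderedPairs n ≡ n C 2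
orderedPairs≡C2 zero = refl
orderedPairs≡C2 (suc n) = begin
  orderedPairs (suc n) ≡⟨ orderedPairs-suc n ⟩
  n ℕ.+ orderedPairs n ≡⟨ cong₂ ℕ._+_ (sym (nC1≡n n)) (orderedPairs≡C2 n) ⟩
  n C 1 ℕ.+ n C 2 ≡⟨ nCk+nC[k+1]≡[n+1]C[k+1] n 1 ⟩
  suc n C 2 ∎

npairs≡C2 : ∀ n → npairs n ≡ n C 2
npairs≡C2 n = begin
  npairs n ≡⟨ sym (ΣFn-1 (npairs n)) ⟩
  ΣFn (npairs n) (λ k → ind true) ≡⟨ Σ-pairs n (λ _ _ → true) ⟩
  orderedPairs n ≡⟨ orderedPairs≡C2 n ⟩
  n C 2 ∎

card-edgeUnion : ∀ n (l : List (Subset n × EdgeSet n)) → card (edgeUnion l) ≡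
  ΣFn n (λ a → ΣFn n (λ b → if does (a <? b) then ind (any (λ x → adj (proj₂ x) a b) l) else 0))
card-edgeUnion n l = begin
  card (edgeUnion l) ≡⟨ card-tab (npairs n) _ ⟩
  ΣFn (npairs n) (λ k → ind (any (λ VE → vlookup (proj₂ VE) k) l))
    ≡⟨ ΣFn-cong (npairs n) (λ k → cong ind (any-cong l (λ x → sym (adj-pairAt n (proj₂ x) k)))) ⟩
  ΣFn (npairs n) (λ k → ind (any (λ x → adj (proj₂ x) (proj₁ (pairAt n k)) (proj₂ (pairAt n k))) l))
    ≡⟨ Σ-pairs n (λ a b → any (λ x → adj (proj₂ x) a b) l) ⟩
  ΣFn n (λ a → ΣFn n (λ b → if does (a <? b) then ind (any (λ x → adj (proj₂ x) a b) l) else 0)) ∎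

edgeUnion-lookup : ∀ {n} (l : List (Subset n × EdgeSet n)) k → vlookup (edgeUnion l) k ≡ any (λ x → vlookup (proj₂ x) k) l
edgeUnion-lookup l k = VP.lookup∘tabulate _ k


preimage : ∀ {n} (V : Subset n) → Fin n → Maybe (Fin (card V))
preimage (true ∷ V) fz = just fz
preimage (true ∷ V) (fs v) = Maybe.map fs (preimage V v)
preimage (false ∷ V) fz = nothing
preimage (false ∷ V) (fs v) = preimage V v

preimage-emb : ∀ {n} (V : Subset n) c → preimage V (emb V c) ≡ just c
preimage-emb (true ∷ V) fz = refl
preimage-emb (true ∷ V) (fs c) rewrite preimage-emb V c = refl
preimage-emb (false ∷ V) c = preimage-emb V c

preimage-just : ∀ {n} (V : Subset n) a c → preimage V a ≡ just c → emb V c ≡ a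
preimage-just (true ∷ V) fz .fz refl = refl
preimage-just (true ∷ V) (fs v) c e with preimage V v in eq
preimage-just (true ∷ V) (fs v) .(fs c′) refl | just c′ = cong fs (preimage-just V v c′ eq)
preimage-just (false ∷ V) (fs v) c e = cong fs (preimage-just V v c e)

preimage-nothing : ∀ {n} (V : Subset n) a → preimage V a ≡ nothing → vlookup V a ≡ false
preimage-nothing (true ∷ V) (fs v) e with preimage V v in eq
preimage-nothing (true ∷ V) (fs v) e | nothing = preimage-nothing V v eq
preimage-nothing (false ∷ V) fz e = refl
preimage-nothing (false ∷ V) (fs v) e = preimage-nothing V v e

preimage-out : ∀ {n} (V : Subset n) a → vlookup V a ≡ false → preimage V a ≡ nothing
preimage-out (true ∷ V) (fs v) e rewrite preimage-out V v e = refl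
preimage-out (false ∷ V) fz e = refl
preimage-out (false ∷ V) (fs v) e = preimage-out V v e

preimage-in : ∀ {n} (V : Subset n) a → vlookup V a ≡ true → ∃[ c ] emb V c ≡ a
preimage-in V a e with preimage V a in eq
... | just c = c , preimage-just V a c eq
... | nothing = ⊥-elim (false≢true (trans (sym (preimage-nothing V a eq)) e))

emb-mono : ∀ {n} (V : Subset n) c d → c Fin.< d → emb V c Fin.< emb V d
emb-mono (true ∷ V) fz (fs d) lt = s≤s z≤n
emb-mono (true ∷ V) (fs c) (fs d) (s≤s lt) = s≤s (emb-mono V c d lt)
emb-mono (false ∷ V) c d lt = s≤s (emb-mono V c d lt)

emb-<⁻ : ∀ {n} (V : Subset n) c d → emb V c Fin.< emb V d → c Fin.< d
emb-<⁻ V c d lt with FP.<-cmp c d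
... | tri< p _ _ = p
... | tri≈ _ e _ = ⊥-elim (ℕP.<-irrefl (cong (λ z → toℕ (emb V z)) e) lt)
... | tri> _ _ p = ⊥-elim (ℕP.<-asym lt (emb-mono V d c p))

does-emb : ∀ {n} (V : Subset n) c d → does (emb V c <? emb V d) ≡ does (c <? d)
does-emb V c d = bool-ext (λ e → dec-true⁺ (c <? d) (emb-<⁻ V c d (dec-true⁻ (emb V c <? emb V d) e)))
                          (λ e → dec-true⁺ (emb V c <? emb V d) (emb-mono V c d (dec-true⁻ (c <? d) e)))

allF-emb : ∀ {n} (V : Subset n) (f : Fin n → Bool) → allF n (λ v → not (vlookup V v) ∨ f v) ≡ allF (card V) (λ c → f (emb V c))
allF-emb [] f = refl
allF-emb (true ∷ V) f = cong (f fz ∧_) (allF-emb V (λ v → f (fs v)))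
allF-emb (false ∷ V) f = allF-emb V (λ v → f (fs v))

ΣFn-emb : ∀ {n} (V : Subset n) (h : Fin n → ℕ) → (∀ v → vlookup V v ≡ false → h v ≡ 0) →
  ΣFn n h ≡ ΣFn (card V) (λ c → h (emb V c))
ΣFn-emb [] h z = refl
ΣFn-emb (true ∷ V) h z = cong (h fz ℕ.+_) (ΣFn-emb V (λ i → h (fs i)) (λ v e → z (fs v) e))
ΣFn-emb (false ∷ V) h z = trans (cong (ℕ._+ ΣFn _ (λ i → h (fs i))) (z fz refl)) (ΣFn-emb V (λ i → h (fs i)) (λ v e → z (fs v) e))

pushV : ∀ {n} (V : Subset n) → Subset (card V) → Subset n
pushV [] [] = []
pushV (true ∷ V) (b ∷ W) = b ∷ pushV V W
pushV (false ∷ V) W = false ∷ pushV V W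

pullV : ∀ {n} (V : Subset n) → Subset n → Subset (card V)
pullV [] [] = []
pullV (true ∷ V) (b ∷ W) = b ∷ pullV V W
pullV (false ∷ V) (b ∷ W) = pullV V W

isSubset : ∀ {k} → Vec Bool k → Vec Bool k → Bool
isSubset [] [] = true
isSubset (e ∷ E) (g ∷ G) = (if e then g else true) ∧ isSubset E G

isSubset-lookup : ∀ {k} (W V : Vec Bool k) → isSubset W V ≡ true → ∀ a → vlookup W a ≡ true → vlookup V a ≡ true
isSubset-lookup (true ∷ W) (true ∷ V) e fz _ = refl
isSubset-lookup (w ∷ W) (v ∷ V) e (fs a) h = isSubset-lookup W V (proj₂ (∧-true e)) a h
isSubset-lookup (true ∷ W) (false ∷ V) () fz _

isSubset-intro : ∀ {k} (W V : Vec Bool k) → (∀ a → vlookup W a ≡ true → vlookup V a ≡ true) → isSubset W V ≡ true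
isSubset-intro [] [] h = refl
isSubset-intro (true ∷ W) (v ∷ V) h rewrite h fz refl = isSubset-intro W V (λ a → h (fs a))
isSubset-intro (false ∷ W) (v ∷ V) h = isSubset-intro W V (λ a → h (fs a))

allF-isSubset : ∀ {K} (E G : Vec Bool K) → allF K (λ k → if vlookup E k then vlookup G k else true) ≡ isSubset E G
allF-isSubset [] [] = refl
allF-isSubset (e ∷ E) (g ∷ G) = cong ((if e then g else true) ∧_) (allF-isSubset E G)

pushV-emb : ∀ {n} (V : Subset n) W c → vlookup (pushV V W) (emb V c) ≡ vlookup W c
pushV-emb (true ∷ V) (b ∷ W) fz = refl
pushV-emb (true ∷ V) (b ∷ W) (fs c) = pushV-emb V W c
pushV-emb (false ∷ V) W c = pushV-emb V W c

card-pushV : ∀ {n} (V : Subset n) W → card (pushV V W) ≡ card W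
card-pushV [] [] = refl
card-pushV (true ∷ V) (true ∷ W) = cong suc (card-pushV V W)
card-pushV (true ∷ V) (false ∷ W) = card-pushV V W
card-pushV (false ∷ V) W = card-pushV V W

isSubset-pushV : ∀ {n} (V : Subset n) W → isSubset (pushV V W) V ≡ true
isSubset-pushV [] [] = refl
isSubset-pushV (true ∷ V) (true ∷ W) = isSubset-pushV V W
isSubset-pushV (true ∷ V) (false ∷ W) = isSubset-pushV V W
isSubset-pushV (false ∷ V) W = isSubset-pushV V W

pull-push : ∀ {n} (V : Subset n) W → pullV V (pushV V W) ≡ W
pull-push [] [] = refl
pull-push (true ∷ V) (b ∷ W) = cong (b ∷_) (pull-push V W)
pull-push (false ∷ V) W = pull-push V W

push-pull : ∀ {n} (V : Subset n) W → isSubset W V ≡ true → pushV V (pullV V W) ≡ W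
push-pull [] [] e = refl
push-pull (true ∷ V) (b ∷ W) e = cong (b ∷_) (push-pull V W (proj₂ (∧-true e)))
push-pull (false ∷ V) (false ∷ W) e = cong (false ∷_) (push-pull V W e)

emb-pushV : ∀ {n} (V : Subset n) W c → emb (pushV V W) c ≡ emb V (emb W (Fin.cast (card-pushV V W) c))
emb-pushV [] [] ()
emb-pushV (true ∷ V) (true ∷ W) fz = refl
emb-pushV (true ∷ V) (true ∷ W) (fs c) = cong fs (emb-pushV V W c)
emb-pushV (true ∷ V) (false ∷ W) c = cong fs (emb-pushV V W c)
emb-pushV (false ∷ V) W c = cong fs (emb-pushV V W c)

adjM : ∀ {i} → EdgeSet i → Maybe (Fin i) → Maybe (Fin i) → Bool
adjM E (just c) (just d) = adj E c d
adjM E (just c) nothing = false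
adjM E nothing y = false

adjM-nothingʳ : ∀ {i} (E : EdgeSet i) x → adjM {i} E x nothing ≡ false
adjM-nothingʳ E (just c) = refl
adjM-nothingʳ E nothing = refl

pushF : ∀ {n} (V : Subset n) → EdgeSet (card V) → Fin n → Fin n → Bool
pushF V E a b = adjM {card V} E (preimage V a) (preimage V b)

pushE : ∀ {n} (V : Subset n) → EdgeSet (card V) → EdgeSet n
pushE V E = fromAdj (pushF V E)

adj-pushE-emb : ∀ {n} (V : Subset n) (E : EdgeSet (card V)) c d → adj (pushE V E) (emb V c) (emb V d) ≡ adj E c d
adj-pushE-emb {n} V E c d with FP.<-cmp c d
... | tri< lt _ _ = trans (adj-fromAdj (pushF V E) (emb V c) (emb V d) (emb-mono V c d lt)) (cong₂ (adjM {card V} E) (preimage-emb V c) (preimage-emb V d))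
... | tri≈ _ refl _ = trans (adj-diag n (pushE V E) (emb V c)) (sym (adj-diag (card V) E c))
... | tri> _ _ gt = begin
  adj (pushE V E) (emb V c) (emb V d) ≡⟨ adj-sym n (pushE V E) _ _ ⟩
  adj (pushE V E) (emb V d) (emb V c) ≡⟨ adj-fromAdj (pushF V E) (emb V d) (emb V c) (emb-mono V d c gt) ⟩
  adjM {card V} E (preimage V (emb V d)) (preimage V (emb V c)) ≡⟨ cong₂ (adjM {card V} E) (preimage-emb V d) (preimage-emb V c) ⟩
  adj E d c ≡⟨ adj-sym (card V) E d c ⟩
  adj E c d ∎

adj-pushE-out : ∀ {n} (V : Subset n) (E : EdgeSet (card V)) a b → vlookup V a ≡ false → adj (pushE V E) a b ≡ false
adj-pushE-out {n} V E a b e with FP.<-cmp a b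
... | tri< lt _ _ = trans (adj-fromAdj (pushF V E) a b lt) (cong (λ z → adjM {card V} E z (preimage V b)) (preimage-out V a e))
... | tri≈ _ refl _ = adj-diag n (pushE V E) a
... | tri> _ _ gt = trans (adj-sym n (pushE V E) a b) (trans (adj-fromAdj (pushF V E) b a gt)
   (trans (cong (adjM {card V} E (preimage V b)) (preimage-out V a e)) (adjM-nothingʳ {card V} E (preimage V b))))

relabel-pushE : ∀ {n} (V : Subset n) (E : EdgeSet (card V)) → relabel V (pushE V E) ≡ E
relabel-pushE V E = trans (VP.tabulate-cong (λ k → adj-pushE-emb V E _ _)) (fromAdj-adj (card V) E)

pushE-relabel : ∀ {n} (V : Subset n) (E′ : EdgeSet n) → (∀ a b → adj E′ a b ≡ true → vlookup V a ≡ true) →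
  pushE V (relabel V E′) ≡ E′
pushE-relabel {n} V E′ h = edge-ext n _ E′ k
  where
  k : ∀ a b → a Fin.< b → adj (pushE V (relabel V E′)) a b ≡ adj E′ a b
  k a b lt = trans (adj-fromAdj (pushF V (relabel V E′)) a b lt) (k′ a b lt)
    where
    k′ : ∀ a b → a Fin.< b → adjM {card V} (relabel V E′) (preimage V a) (preimage V b) ≡ adj E′ a b
    k′ a b lt with preimage V a in ea | preimage V b in eb
    ... | just c | just d = begin
      adj (relabel V E′) c d ≡⟨ adj-fromAdj (λ c d → adj E′ (emb V c) (emb V d)) c d cd ⟩
      adj E′ (emb V c) (emb V d) ≡⟨ cong₂ (adj E′) (preimage-just V a c ea) (preimage-just V b d eb) ⟩
      adj E′ a b ∎
      where
      cd : c Fin.< d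
      cd = emb-<⁻ V c d (subst₂ Fin._<_ (sym (preimage-just V a c ea)) (sym (preimage-just V b d eb)) lt)
    ... | just c | nothing = sym (notTrue (λ t → false≢true (trans (sym (preimage-nothing V b eb)) (h b a (trans (adj-sym n E′ b a) t)))))
    ... | nothing | _ = sym (notTrue (λ t → false≢true (trans (sym (preimage-nothing V a ea)) (h a b t))))

pushE-inj : ∀ {n} (V : Subset n) (E E′ : EdgeSet (card V)) → pushE V E ≡ pushE V E′ → E ≡ E′
pushE-inj V E E′ e = trans (sym (relabel-pushE V E)) (trans (cong (relabel V) e) (relabel-pushE V E′))


-- Transport along V ⊆ Fin n maps the pieces on
-- Fin (card V) bijectively onto the pieces on Fin n whose vertices lie in V,
-- and the F-subgraphs of a graph G are exactly the pieces whose edges lie in G.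

endpointsIn : ∀ n → Subset n → EdgeSet n → Bool
endpointsIn n W E = all (λ k → if vlookup E k
             then vlookup (complete n) k ∧ vlookup W (proj₁ (lookup (pairs n) k))
                              ∧ vlookup W (proj₂ (lookup (pairs n) k))
             else true) (allIdx (pairs n))

endpointsIn-pair : ∀ n W E → endpointsIn n W E ≡ true → ∀ k → vlookup E k ≡ true →
  vlookup W (proj₁ (pairAt n k)) ≡ true × vlookup W (proj₂ (pairAt n k)) ≡ true
endpointsIn-pair n W E e k Ek = ∧-true (proj₂ (∧-true {vlookup (complete n) k} condition-at-k))
  where
  condition-at-k : vlookup (complete n) k ∧ vlookup W (proj₁ (pairAt n k)) ∧ vlookup W (proj₂ (pairAt n k)) ≡ true
  condition-at-k = subst (λ z → (if z then vlookup (complete n) k ∧ vlookup W (proj₁ (pairAt n k)) ∧ vlookup W (proj₂ (pairAt n k)) else true) ≡ true)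
                         Ek (all-true⁻ _ (allFin (npairs n)) e (∈-allFin k))

edge-at : ∀ n (E : EdgeSet n) {a b} k → pairAt n k ≡ (a , b) → adj E a b ≡ true → vlookup E k ≡ true
edge-at n E k ek h = trans (sym (adj-pairAt n E k)) (trans (cong (λ p → adj E (proj₁ p) (proj₂ p)) ek) h)

endpointsIn⁻ : ∀ n W E → endpointsIn n W E ≡ true → ∀ a b → adj E a b ≡ true → vlookup W a ≡ true
endpointsIn⁻ n W E e a b h with FP.<-cmp a b
... | tri< a<b _ _ with pairAt-surj n a b a<b
...   | k , ek = subst (λ p → vlookup W (proj₁ p) ≡ true) ek (proj₁ (endpointsIn-pair n W E e k (edge-at n E k ek h)))
endpointsIn⁻ n W E e a b h | tri≈ _ refl _ = ⊥-elim (false≢true (trans (sym (adj-diag n E a)) h))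
endpointsIn⁻ n W E e a b h | tri> _ _ b<a with pairAt-surj n b a b<a
...   | k , ek = subst (λ p → vlookup W (proj₂ p) ≡ true) ek
                   (proj₂ (endpointsIn-pair n W E e k (edge-at n E k ek (trans (adj-sym n E b a) h))))

endpointsIn⁺ : ∀ n W E → (∀ a b → adj E a b ≡ true → vlookup W a ≡ true) → endpointsIn n W E ≡ true
endpointsIn⁺ n W E h = all-true⁺ _ (allFin (npairs n)) t
  where
  t : ∀ k → (if vlookup E k then vlookup (complete n) k ∧ vlookup W (proj₁ (pairAt n k)) ∧ vlookup W (proj₂ (pairAt n k)) else true) ≡ true
  t k with vlookup E k in eE
  ... | false = refl
  ... | true rewrite VP.lookup-replicate k true
                   | h (proj₁ (pairAt n k)) (proj₂ (pairAt n k)) (trans (adj-pairAt n E k) eE)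
                   | h (proj₂ (pairAt n k)) (proj₁ (pairAt n k)) (trans (adj-sym n E _ _) (trans (adj-pairAt n E k) eE)) = refl

endpointsIn-push : ∀ {n} (V : Subset n) W E → endpointsIn n (pushV V W) (pushE V E) ≡ endpointsIn (card V) W E
endpointsIn-push {n} V W E = bool-ext to from
  where
  to : endpointsIn n (pushV V W) (pushE V E) ≡ true → endpointsIn (card V) W E ≡ true
  to e = endpointsIn⁺ (card V) W E (λ c d h → trans (sym (pushV-emb V W c))
           (endpointsIn⁻ n (pushV V W) (pushE V E) e (emb V c) (emb V d) (trans (adj-pushE-emb V E c d) h)))
  from : endpointsIn (card V) W E ≡ true → endpointsIn n (pushV V W) (pushE V E) ≡ true
  from e = endpointsIn⁺ n (pushV V W) (pushE V E) k
    where
    k : ∀ a b → adj (pushE V E) a b ≡ true → vlookup (pushV V W) a ≡ true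
    k a b h with vlookup V a in ea | vlookup V b in eb
    ... | false | _ = ⊥-elim (false≢true (trans (sym (adj-pushE-out V E a b ea)) h))
    ... | true | false = ⊥-elim (false≢true (trans (sym (adj-pushE-out V E b a eb)) (trans (adj-sym n (pushE V E) b a) h)))
    ... | true | true with preimage-in V a ea | preimage-in V b eb
    ... | c , refl | d , refl = trans (pushV-emb V W c) (endpointsIn⁻ (card V) W E e c d (trans (sym (adj-pushE-emb V E c d)) h))

Ftrans : ∀ (F : Family) {k k′} (e : k′ ≡ k) (f : Fin k′ → Fin k′ → Bool) (g : Fin k → Fin k → Bool) →
  (∀ a b → f a b ≡ g (Fin.cast e a) (Fin.cast e b)) → F k′ (fromAdj f) ≡ F k (fromAdj g)
Ftrans F refl f g h = cong (F _) (VP.tabulate-cong (λ k → trans (h _ _) (cong₂ g (FP.cast-is-id refl _) (FP.cast-is-id refl _))))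

F-push : ∀ (F : Family) {n} (V : Subset n) W E →
  F (card (pushV V W)) (relabel (pushV V W) (pushE V E)) ≡ F (card W) (relabel W E)
F-push F V W E = Ftrans F (card-pushV V W)
  (λ a b → adj (pushE V E) (emb (pushV V W) a) (emb (pushV V W) b))
  (λ a b → adj E (emb W a) (emb W b))
  (λ a b → trans (cong₂ (adj (pushE V E)) (emb-pushV V W a) (emb-pushV V W b)) (adj-pushE-emb V E _ _))

isFSub-push : ∀ (F : Family) {n} (V : Subset n) W E →
  isFSub F n (complete n) (pushV V W) (pushE V E) ≡ isFSub F (card V) (complete (card V)) W E
isFSub-push F V W E = cong₂ _∧_ (endpointsIn-push V W E) (F-push F V W E)

allSubsets-∈ : ∀ {k} (V : Vec Bool k) → V ∈ allSubsets k
allSubsets-∈ [] = here refl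
allSubsets-∈ {suc k} (true ∷ V) = ∈-++⁺ˡ (∈-map⁺ (true ∷_) (allSubsets-∈ V))
allSubsets-∈ {suc k} (false ∷ V) = ∈-++⁺ʳ (map (true ∷_) (allSubsets k)) (∈-map⁺ (false ∷_) (allSubsets-∈ V))

∷-inj : ∀ {k} {b : Bool} {u v : Vec Bool k} → b ∷ u ≡ b ∷ v → u ≡ v
∷-inj refl = refl

allSubsets-unique : ∀ k → Unique (allSubsets k)
allSubsets-unique zero = All.[] ∷ []
allSubsets-unique (suc k) = UP.++⁺ (UP.map⁺ ∷-inj (allSubsets-unique k)) (UP.map⁺ ∷-inj (allSubsets-unique k)) disj
  where
  disj : ∀ {v} → v ∈ map (true ∷_) (allSubsets k) × v ∈ map (false ∷_) (allSubsets k) → ⊥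
  disj (m1 , m2) with ∈-map⁻ (true ∷_) m1 | ∈-map⁻ (false ∷_) m2
  ... | _ , _ , refl | _ , _ , ()

candidates : (n : ℕ) → List (Subset n × EdgeSet n)
candidates n = cartesianProduct (allSubsets n) (allSubsets (npairs n))

candidates-unique : ∀ n → Unique (candidates n)
candidates-unique n = UP.cartesianProduct⁺ (allSubsets-unique n) (allSubsets-unique (npairs n))

isPiece : Family → (n : ℕ) → Subset n × EdgeSet n → Bool
isPiece F n VE = isFSub F n (complete n) (proj₁ VE) (proj₂ VE)

pieces-unique : ∀ F n → Unique (pieces F n)
pieces-unique F n = UP.filter⁺ (λ VE → T? (isPiece F n VE)) (candidates-unique n)

∈-pieces⁺ : ∀ F n (x : Subset n × EdgeSet n) → isPiece F n x ≡ true → x ∈ pieces F n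
∈-pieces⁺ F n (W , E) e = ∈-filter⁺ (λ VE → T? (isPiece F n VE)) (∈-cartesianProduct⁺ (allSubsets-∈ W) (allSubsets-∈ E)) (≡→T e)

∈-pieces⁻ : ∀ F n (x : Subset n × EdgeSet n) → x ∈ pieces F n → isPiece F n x ≡ true
∈-pieces⁻ F n x m = T→≡ (proj₂ (∈-filter⁻ (λ VE → T? (isPiece F n VE)) {xs = candidates n} m))

push : ∀ {n} (V : Subset n) → Subset (card V) × EdgeSet (card V) → Subset n × EdgeSet n
push V (W , E) = pushV V W , pushE V E

push-inj : ∀ {n} (V : Subset n) {x y} → push V x ≡ push V y → x ≡ y
push-inj V {W , E} {W′ , E′} e = cong₂ _,_
  (trans (sym (pull-push V W)) (trans (cong (pullV V) (cong proj₁ e)) (pull-push V W′)))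
  (pushE-inj V E E′ (cong proj₂ e))

insideV : ∀ {n} → Subset n → Subset n × EdgeSet n → Bool
insideV V x = isSubset (proj₁ x) V

pushedPieces : Family → ∀ {n} → Subset n → List (Subset n × EdgeSet n)
pushedPieces F V = map (push V) (pieces F (card V))

piecesInside : Family → ∀ {n} → Subset n → List (Subset n × EdgeSet n)
piecesInside F {n} V = filter (λ x → T? (insideV V x)) (pieces F n)

pushedPieces↭piecesInside : ∀ (F : Family) {n} (V : Subset n) → pushedPieces F V ↭ piecesInside F V
pushedPieces↭piecesInside F {n} V = ∼bag⇒↭ (unique∧set⇒bag pushed-unique inside-unique (λ {y} → mk⇔ (pushed⊆inside y) (inside⊆pushed y)))
  where
  pushed-unique : Unique (pushedPieces F V)
  pushed-unique = UP.map⁺ (push-inj V) (pieces-unique F (card V))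
  inside-unique : Unique (piecesInside F V)
  inside-unique = UP.filter⁺ (λ x → T? (insideV V x)) (pieces-unique F n)
  pushed⊆inside : ∀ y → y ∈ pushedPieces F V → y ∈ piecesInside F V
  pushed⊆inside y m with ∈-map⁻ (push V) m
  ... | (W , E) , mx , refl = ∈-filter⁺ (λ x → T? (insideV V x))
          (∈-pieces⁺ F n (push V (W , E)) (trans (isFSub-push F V W E) (∈-pieces⁻ F (card V) (W , E) mx)))
          (≡→T (isSubset-pushV V W))
  inside⊆pushed : ∀ y → y ∈ piecesInside F V → y ∈ pushedPieces F V
  inside⊆pushed (W′ , E′) m = subst (_∈ pushedPieces F V) push-pulled (∈-map⁺ (push V) (∈-pieces⁺ F (card V) pulled pulled-piece))
    where
    mem = ∈-filter⁻ (λ x → T? (insideV V x)) {xs = pieces F n} m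
    piece : isPiece F n (W′ , E′) ≡ true
    piece = ∈-pieces⁻ F n (W′ , E′) (proj₁ mem)
    inside : isSubset W′ V ≡ true
    inside = T→≡ (proj₂ mem)
    ends-in-W′ : ∀ a b → adj E′ a b ≡ true → vlookup W′ a ≡ true
    ends-in-W′ = endpointsIn⁻ n W′ E′ (proj₁ (∧-true {endpointsIn n W′ E′} piece))
    pulled = pullV V W′ , relabel V E′
    push-pulled : push V pulled ≡ (W′ , E′)
    push-pulled = cong₂ _,_ (push-pull V W′ inside) (pushE-relabel V E′ (λ a b h → isSubset-lookup W′ V inside a (ends-in-W′ a b h)))
    pulled-piece : isPiece F (card V) pulled ≡ true
    pulled-piece = trans (sym (isFSub-push F V (pullV V W′) (relabel V E′))) (trans (cong (isPiece F n) push-pulled) piece)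

ends-split : ∀ {K} (e g c a : Fin K → Bool) → (∀ k → c k ≡ true) →
  allF K (λ k → if e k then g k ∧ a k else true) ≡ allF K (λ k → if e k then c k ∧ a k else true) ∧ allF K (λ k → if e k then g k else true)
ends-split {zero} e g c a hc = refl
ends-split {suc K} e g c a hc with e fz | g fz | c fz | hc fz | a fz
... | false | _ | _ | _ | _ = ends-split (λ k → e (fs k)) (λ k → g (fs k)) (λ k → c (fs k)) (λ k → a (fs k)) (λ k → hc (fs k))
... | true | true | true | _ | true = ends-split (λ k → e (fs k)) (λ k → g (fs k)) (λ k → c (fs k)) (λ k → a (fs k)) (λ k → hc (fs k))
... | true | true | true | _ | false = refl
... | true | false | true | _ | true = sym (∧-zeroʳ _)
... | true | false | true | _ | false = refl

isFSub-as-piece : ∀ (F : Family) n (G : EdgeSet n) (x : Subset n × EdgeSet n) → isFSub F n G (proj₁ x) (proj₂ x) ≡ isPiece F n x ∧ isSubset (proj₂ x) G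
isFSub-as-piece F n G (W , E) = begin
  isFSub F n G W E ≡⟨ cong (_∧ F (card W) (relabel W E)) (trans (all-tab {npairs n} _)
     (trans (ends-split (vlookup E) (vlookup G) (vlookup (complete n)) (λ k → vlookup W (proj₁ (pairAt n k)) ∧ vlookup W (proj₂ (pairAt n k)))
               (λ k → VP.lookup-replicate k true))
        (cong₂ _∧_ (sym (all-tab {npairs n} _)) (trans (sym (all-tab {npairs n} _)) (trans (all-tab {npairs n} _) (allF-isSubset E G)))))) ⟩
  (endpointsIn n W E ∧ isSubset E G) ∧ F (card W) (relabel W E) ≡⟨ ∧-rot (endpointsIn n W E) (isSubset E G) _ ⟩
  (endpointsIn n W E ∧ F (card W) (relabel W E)) ∧ isSubset E G ∎

FSubs-as-filter : ∀ (F : Family) n (G : EdgeSet n) → FSubs F n G ≡ filter (λ x → T? (isSubset (proj₂ x) G)) (pieces F n)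
FSubs-as-filter F n G = trans (filter-cong _ (λ y → isPiece F n y ∧ isSubset (proj₂ y) G) (candidates n) (isFSub-as-piece F n G))
                     (sym (filter-filter (λ x → isSubset (proj₂ x) G) (isPiece F n) (candidates n)))

all-isSubset-edgeUnion : ∀ {n} (G : EdgeSet n) (l : List (Subset n × EdgeSet n)) → all (λ x → isSubset (proj₂ x) G) l ≡ isSubset (edgeUnion l) G
all-isSubset-edgeUnion G l = bool-ext to from
  where
  to : all (λ x → isSubset (proj₂ x) G) l ≡ true → isSubset (edgeUnion l) G ≡ true
  to e = isSubset-intro (edgeUnion l) G (λ k h → let (x , m , hx) = any-true⁻ _ l (trans (sym (edgeUnion-lookup l k)) h)
                                              in isSubset-lookup (proj₂ x) G (all-true⁻ _ l e m) k hx)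
  from : isSubset (edgeUnion l) G ≡ true → all (λ x → isSubset (proj₂ x) G) l ≡ true
  from e = all-true⁺∈ _ l (λ x m → isSubset-intro (proj₂ x) G (λ k h →
             isSubset-lookup (edgeUnion l) G e k (trans (edgeUnion-lookup l k) (any-true⁺ (λ x → vlookup (proj₂ x) k) m h))))


-- A set of pieces on Fin n
-- with vertex union V is the transport of a set of pieces on Fin (card V)
-- covering all its vertices, i.e. of a canonically labelled patchwork, with
-- the same number of pieces and of edges.

vertexUnion : ∀ {n} → List (Subset n × EdgeSet n) → Subset n
vertexUnion l = vtabulate (λ v → any (λ x → vlookup (proj₁ x) v) l)

covers : ∀ {n} → Subset n → List (Subset n × EdgeSet n) → Bool
covers {n} V l = all (λ v → not (vlookup V v) ∨ any (λ x → vlookup (proj₁ x) v) l) (allFin n)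

eqV-true⁻ : ∀ {k} (X V : Vec Bool k) → eqV X V ≡ true → ∀ v → vlookup X v ≡ vlookup V v
eqV-true⁻ (true ∷ X) (true ∷ V) e fz = refl
eqV-true⁻ (false ∷ X) (false ∷ V) e fz = refl
eqV-true⁻ (true ∷ X) (false ∷ V) () fz
eqV-true⁻ (false ∷ X) (true ∷ V) () fz
eqV-true⁻ (x ∷ X) (y ∷ V) e (fs v) = eqV-true⁻ X V (proj₂ (∧-true {eqB x y} e)) v

eqV-true⁺ : ∀ {k} (X V : Vec Bool k) → (∀ v → vlookup X v ≡ vlookup V v) → eqV X V ≡ true
eqV-true⁺ [] [] h = refl
eqV-true⁺ (x ∷ X) (y ∷ V) h with h fz
eqV-true⁺ (true ∷ X) (.true ∷ V) h | refl = eqV-true⁺ X V (λ v → h (fs v))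
eqV-true⁺ (false ∷ X) (.false ∷ V) h | refl = eqV-true⁺ X V (λ v → h (fs v))

vertexUnion-lookup : ∀ {n} (l : List (Subset n × EdgeSet n)) v → vlookup (vertexUnion l) v ≡ any (λ x → vlookup (proj₁ x) v) l
vertexUnion-lookup l v = VP.lookup∘tabulate _ v

eqV-vertexUnion : ∀ {n} (V : Subset n) (l : List (Subset n × EdgeSet n)) → eqV (vertexUnion l) V ≡ all (insideV V) l ∧ covers V l
eqV-vertexUnion {n} V l = bool-ext to from
  where
  to : eqV (vertexUnion l) V ≡ true → all (insideV V) l ∧ covers V l ≡ true
  to e = cong₂ _∧_ (all-true⁺∈ (insideV V) l (λ x m → isSubset-intro (proj₁ x) V (λ a h →
            trans (sym (eqV-true⁻ (vertexUnion l) V e a)) (trans (vertexUnion-lookup l a) (any-true⁺ (λ x → vlookup (proj₁ x) a) m h)))))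
         (all-true⁺ _ (allFin n) covered)
    where
    covered : ∀ v → not (vlookup V v) ∨ any (λ x → vlookup (proj₁ x) v) l ≡ true
    covered v with vlookup V v in ev
    ... | false = refl
    ... | true = trans (sym (vertexUnion-lookup l v)) (trans (eqV-true⁻ (vertexUnion l) V e v) ev)
  from : all (insideV V) l ∧ covers V l ≡ true → eqV (vertexUnion l) V ≡ true
  from e = eqV-true⁺ (vertexUnion l) V (λ v → trans (vertexUnion-lookup l v) (bool-ext (union⊆V v) (V⊆union v)))
    where
    all-inside = proj₁ (∧-true {all (insideV V) l} e)
    covering = proj₂ (∧-true {all (insideV V) l} e)
    union⊆V : ∀ v → any (λ x → vlookup (proj₁ x) v) l ≡ true → vlookup V v ≡ true
    union⊆V v h with any-true⁻ _ l h
    ... | x , m , hx = isSubset-lookup (proj₁ x) V (all-true⁻ (insideV V) l all-inside m) v hx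
    V⊆union : ∀ v → vlookup V v ≡ true → any (λ x → vlookup (proj₁ x) v) l ≡ true
    V⊆union v h = subst (λ z → not z ∨ any (λ x → vlookup (proj₁ x) v) l ≡ true) h
               (all-true⁻ (λ v → not (vlookup V v) ∨ any (λ x → vlookup (proj₁ x) v) l) (allFin n) covering (∈-allFin v))

covers-push : ∀ {n} (V : Subset n) (l : List (Subset (card V) × EdgeSet (card V))) →
  covers V (map (push V) l) ≡ coversAll l
covers-push {n} V l = begin
  all (λ v → not (vlookup V v) ∨ any (λ x → vlookup (proj₁ x) v) (map (push V) l)) (allFin n)
    ≡⟨ all-tab {n} (λ v → not (vlookup V v) ∨ any (λ x → vlookup (proj₁ x) v) (map (push V) l)) ⟩
  allF n (λ v → not (vlookup V v) ∨ any (λ x → vlookup (proj₁ x) v) (map (push V) l))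
    ≡⟨ allF-emb V (λ v → any (λ x → vlookup (proj₁ x) v) (map (push V) l)) ⟩
  allF (card V) (λ c → any (λ x → vlookup (proj₁ x) (emb V c)) (map (push V) l))
    ≡⟨ allF-cong (card V) (λ c → trans (any-map _ (push V) l) (any-cong l (λ x → pushV-emb V (proj₁ x) c))) ⟩
  allF (card V) (λ c → any (λ x → vlookup (proj₁ x) c) l)
    ≡⟨ sym (all-tab {card V} (λ c → any (λ x → vlookup (proj₁ x) c) l)) ⟩
  coversAll l ∎

covers-perm : ∀ {n} (V : Subset n) {l l′ : List (Subset n × EdgeSet n)} → l ↭ l′ → covers V l ≡ covers V l′
covers-perm {n} V p = all-cong (allFin n) (λ v → cong (not (vlookup V v) ∨_) (any-perm _ p))

edgeUnion-perm : ∀ {n} {l l′ : List (Subset n × EdgeSet n)} → l ↭ l′ → edgeUnion l ≡ edgeUnion l′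
edgeUnion-perm p = VP.tabulate-cong (λ k → any-perm _ p)

card-edgeUnion-push : ∀ {n} (V : Subset n) (l : List (Subset (card V) × EdgeSet (card V))) →
  card (edgeUnion (map (push V) l)) ≡ card (edgeUnion l)
card-edgeUnion-push {n} V l = begin
  card (edgeUnion (map (push V) l)) ≡⟨ card-edgeUnion n (map (push V) l) ⟩
  ΣFn n (λ a → ΣFn n (λ b → orderedEdge a b))
    ≡⟨ ΣFn-emb V (λ a → ΣFn n (λ b → orderedEdge a b))
         (λ a ea → ΣFn-0 n _ (λ b → trans (cong (λ z → if does (a <? b) then ind z else 0) (adjUnion-outside a b ea)) (ifz _))) ⟩
  ΣFn (card V) (λ c → ΣFn n (λ b → orderedEdge (emb V c) b))
    ≡⟨ ΣFn-cong (card V) (λ c → ΣFn-emb V (λ b → orderedEdge (emb V c) b) (λ b eb →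
         trans (cong (λ z → if does (emb V c <? b) then ind z else 0) (trans (adjUnion-sym (emb V c) b) (adjUnion-outside b (emb V c) eb))) (ifz _))) ⟩
  ΣFn (card V) (λ c → ΣFn (card V) (λ d → orderedEdge (emb V c) (emb V d)))
    ≡⟨ ΣFn-cong (card V) (λ c → ΣFn-cong (card V) (λ d →
          cong₂ (λ u z → if u then ind z else 0) (does-emb V c d) (trans (adjUnion-map (emb V c) (emb V d)) (any-cong l (λ x → adj-pushE-emb V (proj₂ x) c d))))) ⟩
  ΣFn (card V) (λ c → ΣFn (card V) (λ d → if does (c <? d) then ind (any (λ x → adj (proj₂ x) c d) l) else 0))
    ≡⟨ sym (card-edgeUnion (card V) l) ⟩
  card (edgeUnion l) ∎
  where
  adjUnion : Fin n → Fin n → Bool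
  adjUnion a b = any (λ x → adj (proj₂ x) a b) (map (push V) l)
  orderedEdge : Fin n → Fin n → ℕ
  orderedEdge a b = if does (a <? b) then ind (adjUnion a b) else 0
  adjUnion-map : ∀ a b → adjUnion a b ≡ any (λ x → adj (pushE V (proj₂ x)) a b) l
  adjUnion-map a b = any-map (λ x → adj (proj₂ x) a b) (push V) l
  adjUnion-outside : ∀ a b → vlookup V a ≡ false → adjUnion a b ≡ false
  adjUnion-outside a b ea = trans (adjUnion-map a b) (any-false _ l (λ x → adj-pushE-out V (proj₂ x) a b ea))
  adjUnion-sym : ∀ a b → adjUnion a b ≡ adjUnion b a
  adjUnion-sym a b = any-cong (map (push V) l) (λ x → adj-sym n (proj₂ x) a b)

Σ-with-vertexUnion : ∀ (F : Family) {n} (V : Subset n) (G : ℕ → ℕ → ℚ) →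
  Σl (sublists (pieces F n)) (λ l → [ eqV (vertexUnion l) V ] * G (length l) (card (edgeUnion l))) ≡
  Σl (sublists (pieces F (card V))) (λ l → [ coversAll l ] * G (length l) (card (edgeUnion l)))
Σ-with-vertexUnion F {n} V G = begin
  Σl (sublists L) (λ l → [ eqV (vertexUnion l) V ] * g l)
    ≡⟨ Σl-cong (sublists L) (λ l → trans (cong (λ z → [ z ] * g l) (eqV-vertexUnion V l))
                                (trans (cong (_* g l) ([∧] (all (insideV V) l) (covers V l))) (*-assoc [ all (insideV V) l ] [ covers V l ] (g l)))) ⟩
  Σl (sublists L) (λ l → [ all (insideV V) l ] * ([ covers V l ] * g l))
    ≡⟨ sym (subs-filter (insideV V) L (λ l → [ covers V l ] * g l)) ⟩
  Σl (sublists (piecesInside F V)) (λ l → [ covers V l ] * g l)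
    ≡⟨ sym (subs-perm (pushedPieces↭piecesInside F V) (λ l → [ covers V l ] * g l)
          (λ p → cong₂ (λ a b → [ a ] * b) (covers-perm V p) (cong₂ G (↭-length p) (cong card (edgeUnion-perm p))))) ⟩
  Σl (sublists (pushedPieces F V)) (λ l → [ covers V l ] * g l)
    ≡⟨ subs-map (push V) (pieces F (card V)) (λ l → [ covers V l ] * g l) ⟩
  Σl (sublists (pieces F (card V))) (λ l → [ covers V (map (push V) l) ] * g (map (push V) l))
    ≡⟨ Σl-cong (sublists (pieces F (card V))) (λ l → cong₂ (λ a b → [ a ] * b) (covers-push V l)
           (cong₂ G (length-map (push V) l) (card-edgeUnion-push V l))) ⟩
  Σl (sublists (pieces F (card V))) (λ l → [ coversAll l ] * G (length l) (card (edgeUnion l))) ∎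
  where
  L = pieces F n
  g : List (Subset n × EdgeSet n) → ℚ
  g l = G (length l) (card (edgeUnion l))

Σ-by-vertexSet : ∀ (F : Family) n (G : ℕ → ℕ → ℚ) →
  Σl (sublists (pieces F n)) (λ l → G (length l) (card (edgeUnion l))) ≡
  Σl (allSubsets n) (λ V → Σl (sublists (pieces F (card V))) (λ l → [ coversAll l ] * G (length l) (card (edgeUnion l))))
Σ-by-vertexSet F n G = begin
  Σl (sublists L) (λ l → g l)
    ≡⟨ Σl-cong (sublists L) (λ l → sym (Σ-unique (vertexUnion l) (λ V → g l))) ⟩
  Σl (sublists L) (λ l → Σl (allSubsets n) (λ V → [ eqV (vertexUnion l) V ] * g l))
    ≡⟨ Σl-swap (sublists L) (allSubsets n) _ ⟩
  Σl (allSubsets n) (λ V → Σl (sublists L) (λ l → [ eqV (vertexUnion l) V ] * g l))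
    ≡⟨ Σl-cong (allSubsets n) (λ V → Σ-with-vertexUnion F V G) ⟩
  Σl (allSubsets n) (λ V → Σl (sublists (pieces F (card V))) (λ l → [ coversAll l ] * G (length l) (card (edgeUnion l)))) ∎
  where
  L = pieces F n
  g : List (Subset n × EdgeSet n) → ℚ
  g l = G (length l) (card (edgeUnion l))


shiftΣ : ∀ {K} (A : List (Vec Bool K)) (X : Vec Bool K → ℚ) m →
  Σl A (λ G → [ suc (card G) ≡ᵇ m ] * X G) ≡ shift (λ m′ → Σl A (λ G → [ card G ≡ᵇ m′ ] * X G)) m
shiftΣ A X zero = Σl-0 A _ (λ G → *-zeroˡ (X G))
shiftΣ A X (suc m) = refl

-- The number of graphs G ⊇ E with m edges on K possible edges is
-- [w^m] (1 + w)^K (w/(1+w))^{|E|}, i.e. C(K − |E|, m − |E|).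
supersets-count : ∀ {K} (E : Vec Bool K) m → Σl (allSubsets K) (λ G → [ card G ≡ᵇ m ] * [ isSubset E G ]) ≡ mul1+w^ K (convPow ω (card E)) m
supersets-count [] zero = refl
supersets-count [] (suc m) = refl
supersets-count {suc K} (true ∷ E) m = begin
  Σl (map (true ∷_) (allSubsets K) ++ map (false ∷_) (allSubsets K)) (λ G → [ card G ≡ᵇ m ] * [ isSubset (true ∷ E) G ])
    ≡⟨ Σl-++ (map (true ∷_) (allSubsets K)) _ _ ⟩
  _ ≡⟨ cong₂ _+_ (Σl-map (true ∷_) (allSubsets K) _) (Σl-map (false ∷_) (allSubsets K) _) ⟩
  Σl (allSubsets K) (λ G → [ suc (card G) ≡ᵇ m ] * [ isSubset E G ]) + Σl (allSubsets K) (λ G → [ card G ≡ᵇ m ] * [ false ])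
    ≡⟨ cong₂ _+_ (shiftΣ (allSubsets K) (λ G → [ isSubset E G ]) m) (Σl-0 (allSubsets K) _ (λ G → *-zeroʳ [ card G ≡ᵇ m ])) ⟩
  shift (λ m′ → Σl (allSubsets K) (λ G → [ card G ≡ᵇ m′ ] * [ isSubset E G ])) m + 0ℚ ≡⟨ +-identityʳ _ ⟩
  shift (λ m′ → Σl (allSubsets K) (λ G → [ card G ≡ᵇ m′ ] * [ isSubset E G ])) m ≡⟨ sh m ⟩
  shift (mul1+w^ K (convPow ω (card E))) m ≡⟨ sym (mul1+w^-ωPow-suc K (card E) m) ⟩
  mul1+w^ (suc K) (convPow ω (suc (card E))) m ∎
  where
  sh : ∀ m → shift (λ m′ → Σl (allSubsets K) (λ G → [ card G ≡ᵇ m′ ] * [ isSubset E G ])) m ≡ shift (mul1+w^ K (convPow ω (card E))) m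
  sh zero = refl
  sh (suc m) = supersets-count E m
supersets-count {suc K} (false ∷ E) m = begin
  Σl (map (true ∷_) (allSubsets K) ++ map (false ∷_) (allSubsets K)) (λ G → [ card G ≡ᵇ m ] * [ isSubset (false ∷ E) G ])
    ≡⟨ Σl-++ (map (true ∷_) (allSubsets K)) _ _ ⟩
  _ ≡⟨ cong₂ _+_ (Σl-map (true ∷_) (allSubsets K) _) (Σl-map (false ∷_) (allSubsets K) _) ⟩
  Σl (allSubsets K) (λ G → [ suc (card G) ≡ᵇ m ] * [ isSubset E G ]) + Σl (allSubsets K) (λ G → [ card G ≡ᵇ m ] * [ isSubset E G ])
    ≡⟨ cong (_+ Σl (allSubsets K) (λ G → [ card G ≡ᵇ m ] * [ isSubset E G ])) (shiftΣ (allSubsets K) (λ G → [ isSubset E G ]) m) ⟩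
  shift gE m + gE m ≡⟨ +-comm (shift gE m) (gE m) ⟩
  mul1+w gE m ≡⟨ mul1+w-cong (supersets-count E) m ⟩
  mul1+w (mul1+w^ K (convPow ω (card E))) m ∎
  where
  gE : Seq
  gE m′ = Σl (allSubsets K) (λ G → [ card G ≡ᵇ m′ ] * [ isSubset E G ])

-- By inclusion–exclusion over the F-subgraphs of G and interchanging sums:
-- SG = Σ_{P ⊆ pieces} [u^t](u − 1)^{|P|} · #{G : |G| = m, E(P) ⊆ G}.
SG-expansion : ∀ (F : Family) n m t → ℕ→ℚ (SG F n m t) ≡
  Σl (sublists (pieces F n)) (λ l → convPow ρ (length l) t * mul1+w^ (npairs n) (convPow ω (card (edgeUnion l))) m)
SG-expansion F n m t = begin
  ℕ→ℚ (SG F n m t)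
    ≡⟨ length-filter (λ G → (card G ≡ᵇ m) ∧ (length (FSubs F n G) ≡ᵇ t)) A ⟩
  Σl A (λ G → [ (card G ≡ᵇ m) ∧ (length (FSubs F n G) ≡ᵇ t) ])
    ≡⟨ Σl-cong A expand ⟩
  Σl A (λ G → Σl (sublists L) (λ l → ρs l * supersetOf l G))
    ≡⟨ Σl-swap A (sublists L) _ ⟩
  Σl (sublists L) (λ l → Σl A (λ G → ρs l * supersetOf l G))
    ≡⟨ Σl-cong (sublists L) (λ l → trans (sym (Σl-*ˡ A (ρs l) _)) (cong (ρs l *_) (supersets-count (edgeUnion l) m))) ⟩
  Σl (sublists L) (λ l → ρs l * mul1+w^ (npairs n) (convPow ω (card (edgeUnion l))) m) ∎
  where
  A = allSubsets (npairs n)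
  L = pieces F n
  ρs : List (Subset n × EdgeSet n) → ℚ
  ρs l = convPow ρ (length l) t
  inG : EdgeSet n → Subset n × EdgeSet n → Bool
  inG G x = isSubset (proj₂ x) G
  supersetOf : List (Subset n × EdgeSet n) → EdgeSet n → ℚ
  supersetOf l G = [ card G ≡ᵇ m ] * [ isSubset (edgeUnion l) G ]
  expand : ∀ G → [ (card G ≡ᵇ m) ∧ (length (FSubs F n G) ≡ᵇ t) ] ≡ Σl (sublists L) (λ l → ρs l * supersetOf l G)
  expand G = begin
    [ (card G ≡ᵇ m) ∧ (length (FSubs F n G) ≡ᵇ t) ]
      ≡⟨ [∧] (card G ≡ᵇ m) _ ⟩
    [ card G ≡ᵇ m ] * [ length (FSubs F n G) ≡ᵇ t ]
      ≡⟨ cong (λ S → [ card G ≡ᵇ m ] * [ length S ≡ᵇ t ]) (FSubs-as-filter F n G) ⟩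
    [ card G ≡ᵇ m ] * [ length (filter (λ x → T? (inG G x)) L) ≡ᵇ t ]
      ≡⟨ cong ([ card G ≡ᵇ m ] *_) (count-indicator-expansion (inG G) L t) ⟩
    [ card G ≡ᵇ m ] * Σl (sublists L) (λ l → ρs l * [ all (inG G) l ])
      ≡⟨ Σl-*ˡ (sublists L) [ card G ≡ᵇ m ] _ ⟩
    Σl (sublists L) (λ l → [ card G ≡ᵇ m ] * (ρs l * [ all (inG G) l ]))
      ≡⟨ Σl-cong (sublists L) (λ l → cong (λ b → [ card G ≡ᵇ m ] * (ρs l * [ b ])) (all-isSubset-edgeUnion G l)) ⟩
    Σl (sublists L) (λ l → [ card G ≡ᵇ m ] * (ρs l * [ isSubset (edgeUnion l) G ]))
      ≡⟨ Σl-cong (sublists L) (λ l → solve 3 (λ a b c → a :* (b :* c) := b :* (a :* c)) refl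
                                       [ card G ≡ᵇ m ] (ρs l) [ isSubset (edgeUnion l) G ]) ⟩
    Σl (sublists L) (λ l → ρs l * supersetOf l G) ∎

patchSum : Family → (t i : ℕ) → (ℕ → ℚ) → ℚ
patchSum F t i g = Σl (sublists (pieces F i))
  (λ l → [ coversAll l ] * (convPow ρ (length l) t * g (card (edgeUnion l))))

patchSum-cong : ∀ F t i {g h : ℕ → ℚ} → (∀ e → g e ≡ h e) → patchSum F t i g ≡ patchSum F t i h
patchSum-cong F t i g≡h = Σl-cong (sublists (pieces F i))
  (λ l → cong (λ x → [ coversAll l ] * (convPow ρ (length l) t * x)) (g≡h (card (edgeUnion l))))

patchSum-linear : ∀ F t i m (c : ℕ → ℚ) (g : ℕ → ℕ → ℚ) →
  Σ≤ m (λ j → c j * patchSum F t i (g j)) ≡ patchSum F t i (λ e → Σ≤ m (λ j → c j * g j e))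
patchSum-linear F t i m c g = begin
  Σ≤ m (λ j → c j * patchSum F t i (g j))
    ≡⟨ Σ≤-cong m (λ j _ → Σl-*ˡ SL (c j) _) ⟩
  Σ≤ m (λ j → Σl SL (λ l → c j * term l (g j)))
    ≡⟨ sym (Σl-Σ≤ SL m (λ l j → c j * term l (g j))) ⟩
  Σl SL (λ l → Σ≤ m (λ j → c j * term l (g j)))
    ≡⟨ Σl-cong SL pull-out ⟩
  patchSum F t i (λ e → Σ≤ m (λ j → c j * g j e)) ∎
  where
  SL = sublists (pieces F i)
  term : List (Subset i × EdgeSet i) → (ℕ → ℚ) → ℚ
  term l h = [ coversAll l ] * (convPow ρ (length l) t * h (card (edgeUnion l)))
  pull-out : ∀ l → Σ≤ m (λ j → c j * term l (g j)) ≡ term l (λ e → Σ≤ m (λ j → c j * g j e))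
  pull-out l = begin
    Σ≤ m (λ j → c j * term l (g j))
      ≡⟨ Σ≤-cong m (λ j _ → solve 4 (λ a b x y → x :* (a :* (b :* y)) := a :* (b :* (x :* y))) refl
                               [ coversAll l ] (convPow ρ (length l) t) (c j) (g j (card (edgeUnion l)))) ⟩
    Σ≤ m (λ j → [ coversAll l ] * (convPow ρ (length l) t * (c j * g j (card (edgeUnion l)))))
      ≡⟨ sym (Σ≤-*ˡ m [ coversAll l ] _) ⟩
    [ coversAll l ] * Σ≤ m (λ j → convPow ρ (length l) t * (c j * g j (card (edgeUnion l))))
      ≡⟨ cong ([ coversAll l ] *_) (sym (Σ≤-*ˡ m (convPow ρ (length l) t) _)) ⟩
    term l (λ e → Σ≤ m (λ j → c j * g j e)) ∎

-- Both sides of the theorem equal Σ_{i ≤ n} C(n,i) · patchworkTerm F n m t i: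
-- the signed count of patchworks on an i-set, weighted by the number of graphs
-- on {1..n} with m edges containing them.
patchworkTerm : Family → (n m t i : ℕ) → ℚ
patchworkTerm F n m t i = patchSum F t i (λ e → mul1+w^ (n C 2) (convPow ω e) m)

-- Counting side: expand [#F-subgraphs = t] by inclusion–exclusion, count the
-- supersets of each patchwork, and group patchworks by their vertex set.
SG-as-patchworks : ∀ F n m t →
  ℕ→ℚ (SG F n m t) ≡ Σ≤ n (λ i → ℕ→ℚ (n C i) * patchworkTerm F n m t i)
SG-as-patchworks F n m t = begin
  ℕ→ℚ (SG F n m t)
    ≡⟨ SG-expansion F n m t ⟩
  Σl (sublists (pieces F n)) (λ l → convPow ρ (length l) t * mul1+w^ (npairs n) (convPow ω (card (edgeUnion l))) m)
    ≡⟨ cong (λ K → Σl (sublists (pieces F n)) (λ l → convPow ρ (length l) t * mul1+w^ K (convPow ω (card (edgeUnion l))) m)) (npairs≡C2 n) ⟩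
  Σl (sublists (pieces F n)) (λ l → convPow ρ (length l) t * mul1+w^ (n C 2) (convPow ω (card (edgeUnion l))) m)
    ≡⟨ Σ-by-vertexSet F n (λ s e → convPow ρ s t * mul1+w^ (n C 2) (convPow ω e) m) ⟩
  Σl (allSubsets n) (λ V → patchworkTerm F n m t (card V))
    ≡⟨ Σ-card n (patchworkTerm F n m t) ⟩
  Σ≤ n (λ i → ℕ→ℚ (n C i) * patchworkTerm F n m t i) ∎


sucCase : ∀ {n i} → i ≤ n → i ≢ n → ∀ (P : ℕ → Set) → (∀ k → P (suc k)) → P (n ∸ i)
sucCase {n} {i} p ne P h with n ∸ i | ℕP.m>n⇒m∸n≢0 (ℕP.≤∧≢⇒< p ne)
... | zero | q = ⊥-elim (q refl)
... | suc k | _ = h k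

zeroCase : ∀ n (P : ℕ → Set) → P 0 → P (n ∸ n)
zeroCase n P h = subst P (sym (ℕP.n∸n≡0 n)) h

⟦binomW⟧ : ∀ K N M u → ⟦ binomW K N M ⟧ u ≡ δ0 N * (mul1+w^ K δ0 M * δ0 u)
⟦binomW⟧ K N M u = trans (serPow-wSer onePlusW K N M u) (cong (λ x → δ0 N * (x * δ0 u)) (onePlusW-pow K M))

coeff-⊛binomW : ∀ (Y : Ser) K n m t → ⟦ (Y ⊛ binomW K) n m ⟧ t ≡ Σ≤ m (λ j → mul1+w^ K δ0 (m ∸ j) * ⟦ Y n j ⟧ t)
coeff-⊛binomW Y K n m t = begin
  ⟦ (Y ⊛ binomW K) n m ⟧ t ≡⟨ ⟦sumTo⟧ n _ t ⟩
  Σ≤ n (λ i → f i) ≡⟨ Σ≤-single n n f ℕP.≤-refl (λ i p ne → sucCase p ne (λ N → fN i N ≡ 0ℚ) (λ k → z i k)) ⟩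
  f n ≡⟨ zeroCase n (λ N → fN n N ≡ Σ≤ m (λ j → mul1+w^ K δ0 (m ∸ j) * ⟦ Y n j ⟧ t)) top ⟩
  Σ≤ m (λ j → mul1+w^ K δ0 (m ∸ j) * ⟦ Y n j ⟧ t) ∎
  where
  fN : ℕ → ℕ → ℚ
  fN i N = ⟦ sumTo m (λ j → pmul (Y i j) (binomW K N (m ∸ j))) ⟧ t
  f : ℕ → ℚ
  f i = fN i (n ∸ i)
  z : ∀ i k → fN i (suc k) ≡ 0ℚ
  z i k = trans (⟦sumTo⟧ m _ t) (Σ≤-0 m _ (λ j _ → trans (⟦pmul⟧ (Y i j) (binomW K (suc k) (m ∸ j)) t)
            (conv-0ʳ ⟦ Y i j ⟧ _ t (λ u → trans (⟦binomW⟧ K (suc k) (m ∸ j) u) (*-zeroˡ (mul1+w^ K δ0 (m ∸ j) * δ0 u))))))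
  top : fN n 0 ≡ Σ≤ m (λ j → mul1+w^ K δ0 (m ∸ j) * ⟦ Y n j ⟧ t)
  top = trans (⟦sumTo⟧ m _ t) (Σ≤-cong m (λ j _ → begin
    ⟦ pmul (Y n j) (binomW K 0 (m ∸ j)) ⟧ t ≡⟨ ⟦pmul⟧ (Y n j) (binomW K 0 (m ∸ j)) t ⟩
    conv ⟦ Y n j ⟧ ⟦ binomW K 0 (m ∸ j) ⟧ t
      ≡⟨ conv-congʳ ⟦ Y n j ⟧ (λ u → trans (⟦binomW⟧ K 0 (m ∸ j) u) (*-identityˡ (mul1+w^ K δ0 (m ∸ j) * δ0 u))) t ⟩
    conv ⟦ Y n j ⟧ (λ u → mul1+w^ K δ0 (m ∸ j) * δ0 u) t
      ≡⟨ conv-*ʳ ⟦ Y n j ⟧ (mul1+w^ K δ0 (m ∸ j)) δ0 t ⟩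
    mul1+w^ K δ0 (m ∸ j) * conv ⟦ Y n j ⟧ δ0 t
      ≡⟨ cong (mul1+w^ K δ0 (m ∸ j) *_) (conv-δ0ʳ ⟦ Y n j ⟧ t) ⟩
    mul1+w^ K δ0 (m ∸ j) * ⟦ Y n j ⟧ t ∎))

coeff-⊛expZ : ∀ (A : Ser) n j t → ⟦ (A ⊛ expZ) n j ⟧ t ≡ Σ≤ n (λ i → ⟦ A i j ⟧ t * invFact (n ∸ i))
coeff-⊛expZ A n j t = trans (⟦sumTo⟧ n _ t) (Σ≤-cong n (λ i _ → begin
  ⟦ sumTo j (λ l → pmul (A i l) (expZ (n ∸ i) (j ∸ l))) ⟧ t ≡⟨ ⟦sumTo⟧ j _ t ⟩
  Σ≤ j (λ l → gN i l (j ∸ l)) ≡⟨ Σ≤-single j j _ ℕP.≤-refl (λ l p ne → sucCase p ne (λ M → gN i l M ≡ 0ℚ) (λ k → z i l k)) ⟩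
  gN i j (j ∸ j) ≡⟨ zeroCase j (λ M → gN i j M ≡ ⟦ A i j ⟧ t * invFact (n ∸ i)) top ⟩
  ⟦ A i j ⟧ t * invFact (n ∸ i) ∎))
  where
  gN : ℕ → ℕ → ℕ → ℚ
  gN i l M = ⟦ pmul (A i l) (expZ (n ∸ i) M) ⟧ t
  z : ∀ i l k → gN i l (suc k) ≡ 0ℚ
  z i l k = trans (⟦pmul⟧ (A i l) [] t) (conv-0ʳ ⟦ A i l ⟧ ⟦ [] ⟧ t (λ _ → refl))
  top : ∀ {i} → gN i j 0 ≡ ⟦ A i j ⟧ t * invFact (n ∸ i)
  top {i} = trans (⟦pmul⟧ (A i j) (invFact (n ∸ i) ∷ []) t) (conv-constʳ (invFact (n ∸ i)) ⟦ A i j ⟧ t)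

coeff-substU-Patch : ∀ (F : Family) i k t →
  ⟦ pcomp (Patch F i k) ((- 1ℚ) ∷ 1ℚ ∷ []) ⟧ t ≡ invFact i * patchSum F t i (λ e → [ e ≡ᵇ k ])
coeff-substU-Patch F i k t = begin
  ⟦ pcomp (Patch F i k) r ⟧ t                     ≡⟨ pcomp-pscale (invFact i) (psum monomials) r t ⟩
  invFact i * ⟦ pcomp (psum monomials) r ⟧ t      ≡⟨ cong (invFact i *_) signed-count ⟩
  invFact i * patchSum F t i (λ e → [ e ≡ᵇ k ]) ∎
  where
  r = (- 1ℚ) ∷ 1ℚ ∷ []
  L = pieces F i
  ok : Subset (length L) → Bool
  ok S = coversAll (selected L S) ∧ (card (edgeUnion (selected L S)) ≡ᵇ k)
  monomials : List Poly
  monomials = map (λ S → pmono (card S)) (filter (λ S → T? (ok S)) (allSubsets (length L)))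
  h : List (Subset i × EdgeSet i) → ℚ
  h l = [ coversAll l ∧ (card (edgeUnion l) ≡ᵇ k) ] * convPow ρ (length l) t
  regroup : ∀ l → h l ≡ [ coversAll l ] * (convPow ρ (length l) t * [ card (edgeUnion l) ≡ᵇ k ])
  regroup l = trans (cong (_* convPow ρ (length l) t) ([∧] (coversAll l) _))
    (solve 3 (λ a b c → (a :* b) :* c := a :* (c :* b)) refl [ coversAll l ] [ card (edgeUnion l) ≡ᵇ k ] (convPow ρ (length l) t))
  signed-count : ⟦ pcomp (psum monomials) r ⟧ t ≡ patchSum F t i (λ e → [ e ≡ᵇ k ])
  signed-count = begin
    ⟦ pcomp (psum monomials) r ⟧ t
      ≡⟨ pcomp-psum monomials r t ⟩
    Σl monomials (λ p → ⟦ pcomp p r ⟧ t)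
      ≡⟨ Σl-map (λ S → pmono (card S)) (filter (λ S → T? (ok S)) (allSubsets (length L))) _ ⟩
    Σl (filter (λ S → T? (ok S)) (allSubsets (length L))) (λ S → ⟦ pcomp (pmono (card S)) r ⟧ t)
      ≡⟨ Σl-filter ok (allSubsets (length L)) _ ⟩
    Σl (allSubsets (length L)) (λ S → [ ok S ] * ⟦ pcomp (pmono (card S)) r ⟧ t)
      ≡⟨ Σl-cong (allSubsets (length L)) (λ S → cong ([ ok S ] *_)
           (trans (pcomp-pmono (card S) r t) (cong (λ c → convPow ρ c t) (card-selected L S)))) ⟩
    Σl (allSubsets (length L)) (λ S → h (selected L S))
      ≡⟨ Σ-allSubsets L h ⟩
    Σl (sublists L) h
      ≡⟨ Σl-cong (sublists L) regroup ⟩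
    patchSum F t i (λ e → [ e ≡ᵇ k ]) ∎

coeff-substU-substW : ∀ (F : Family) i j t →
  ⟦ substU (substW (Patch F)) i j ⟧ t ≡ Σ≤ j (λ k → convPow ω k j * (invFact i * patchSum F t i (λ e → [ e ≡ᵇ k ])))
coeff-substU-substW F i j t = begin
  ⟦ pcomp (sumTo j (λ k → pscale (c k) (Patch F i k))) r ⟧ t
    ≡⟨ pcomp-sumTo j _ r t ⟩
  Σ≤ j (λ k → ⟦ pcomp (pscale (c k) (Patch F i k)) r ⟧ t)
    ≡⟨ Σ≤-cong j (λ k _ → trans (pcomp-pscale (c k) (Patch F i k) r t) (cong₂ _*_ (c≡ωPow k) (coeff-substU-Patch F i k t))) ⟩
  Σ≤ j (λ k → convPow ω k j * (invFact i * patchSum F t i (λ e → [ e ≡ᵇ k ]))) ∎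
  where
  r = (- 1ℚ) ∷ 1ℚ ∷ []
  c : ℕ → ℚ
  c k = pcoeff (serPow (wSer wOver1+w) k 0 j) 0
  c≡ωPow : ∀ k → c k ≡ convPow ω k j
  c≡ωPow k = trans (serPow-wSer ω k 0 j 0) (trans (*-identityˡ (convPow ω k j * 1ℚ)) (*-identityʳ (convPow ω k j)))

coeff-substU-substW-Patch : ∀ F i j t →
  ⟦ substU (substW (Patch F)) i j ⟧ t ≡ invFact i * patchSum F t i (λ e → convPow ω e j)
coeff-substU-substW-Patch F i j t = begin
  ⟦ substU (substW (Patch F)) i j ⟧ t
    ≡⟨ coeff-substU-substW F i j t ⟩
  Σ≤ j (λ k → convPow ω k j * (invFact i * patchSum F t i (λ e → [ e ≡ᵇ k ])))
    ≡⟨ Σ≤-cong j (λ k _ → solve 3 (λ a b c → a :* (b :* c) := b :* (a :* c)) refl (convPow ω k j) (invFact i) _) ⟩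
  Σ≤ j (λ k → invFact i * (convPow ω k j * patchSum F t i (λ e → [ e ≡ᵇ k ])))
    ≡⟨ sym (Σ≤-*ˡ j (invFact i) _) ⟩
  invFact i * Σ≤ j (λ k → convPow ω k j * patchSum F t i (λ e → [ e ≡ᵇ k ]))
    ≡⟨ cong (invFact i *_) (patchSum-linear F t i j (λ k → convPow ω k j) (λ k e → [ e ≡ᵇ k ])) ⟩
  invFact i * patchSum F t i (λ e → Σ≤ j (λ k → convPow ω k j * [ e ≡ᵇ k ]))
    ≡⟨ cong (invFact i *_) (patchSum-cong F t i (Σ-ωPow-select j)) ⟩
  invFact i * patchSum F t i (λ e → convPow ω e j) ∎

-- n! · Σ_j β_j Σ_{i ≤ n} (W_{ij}/i!)/(n−i)! = Σ_{i ≤ n} C(n,i) Σ_j β_j W_{ij}: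
-- the exponential convolution with e^z produces binomial coefficients.
factorials-to-binomials : ∀ n m (β : ℕ → ℚ) (W : ℕ → ℕ → ℚ) →
  ℕ→ℚ (n !) * Σ≤ m (λ j → β j * Σ≤ n (λ i → (invFact i * W i j) * invFact (n ∸ i))) ≡
  Σ≤ n (λ i → ℕ→ℚ (n C i) * Σ≤ m (λ j → β j * W i j))
factorials-to-binomials n m β W = begin
  N * Σ≤ m (λ j → β j * Σ≤ n (λ i → (invFact i * W i j) * invFact (n ∸ i)))
    ≡⟨ Σ≤-*ˡ m N _ ⟩
  Σ≤ m (λ j → N * (β j * Σ≤ n (λ i → (invFact i * W i j) * invFact (n ∸ i))))
    ≡⟨ Σ≤-cong m (λ j _ → distribute j) ⟩
  Σ≤ m (λ j → Σ≤ n (λ i → (N * (invFact i * invFact (n ∸ i))) * (β j * W i j)))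
    ≡⟨ Σ≤-swap m n _ ⟩
  Σ≤ n (λ i → Σ≤ m (λ j → (N * (invFact i * invFact (n ∸ i))) * (β j * W i j)))
    ≡⟨ Σ≤-cong n (λ i i≤n → trans (sym (Σ≤-*ˡ m (N * (invFact i * invFact (n ∸ i))) _))
                                  (cong (_* Σ≤ m (λ j → β j * W i j)) (factorials-to-binomial n i i≤n))) ⟩
  Σ≤ n (λ i → ℕ→ℚ (n C i) * Σ≤ m (λ j → β j * W i j)) ∎
  where
  N = ℕ→ℚ (n !)
  distribute : ∀ j → N * (β j * Σ≤ n (λ i → (invFact i * W i j) * invFact (n ∸ i))) ≡
                     Σ≤ n (λ i → (N * (invFact i * invFact (n ∸ i))) * (β j * W i j))
  distribute j = begin
    N * (β j * Σ≤ n (λ i → (invFact i * W i j) * invFact (n ∸ i)))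
      ≡⟨ cong (N *_) (Σ≤-*ˡ n (β j) _) ⟩
    N * Σ≤ n (λ i → β j * ((invFact i * W i j) * invFact (n ∸ i)))
      ≡⟨ Σ≤-*ˡ n N _ ⟩
    Σ≤ n (λ i → N * (β j * ((invFact i * W i j) * invFact (n ∸ i))))
      ≡⟨ Σ≤-cong n (λ i _ → solve 5 (λ N b a w c → N :* (b :* ((a :* w) :* c)) := (N :* (a :* c)) :* (b :* w)) refl
                                 N (β j) (invFact i) (W i j) (invFact (n ∸ i))) ⟩
    Σ≤ n (λ i → (N * (invFact i * invFact (n ∸ i))) * (β j * W i j)) ∎

coefficient-as-patchworks : ∀ F n m t →
  ℕ→ℚ (n !) * coeff ((substU (substW (Patch F)) ⊛ expZ) ⊛ binomW (n C 2)) n m t ≡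
  Σ≤ n (λ i → ℕ→ℚ (n C i) * patchworkTerm F n m t i)
coefficient-as-patchworks F n m t = begin
  ℕ→ℚ (n !) * coeff ((Y ⊛ expZ) ⊛ binomW K) n m t
    ≡⟨ cong (ℕ→ℚ (n !) *_) (coeff-⊛binomW (Y ⊛ expZ) K n m t) ⟩
  ℕ→ℚ (n !) * Σ≤ m (λ j → β j * ⟦ (Y ⊛ expZ) n j ⟧ t)
    ≡⟨ cong (ℕ→ℚ (n !) *_) (Σ≤-cong m (λ j _ → cong (β j *_) (coeff-⊛expZ Y n j t))) ⟩
  ℕ→ℚ (n !) * Σ≤ m (λ j → β j * Σ≤ n (λ i → ⟦ Y i j ⟧ t * invFact (n ∸ i)))
    ≡⟨ cong (ℕ→ℚ (n !) *_) (Σ≤-cong m (λ j _ → cong (β j *_) (Σ≤-cong n (λ i _ →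
         cong (_* invFact (n ∸ i)) (coeff-substU-substW-Patch F i j t))))) ⟩
  ℕ→ℚ (n !) * Σ≤ m (λ j → β j * Σ≤ n (λ i → (invFact i * W i j) * invFact (n ∸ i)))
    ≡⟨ factorials-to-binomials n m β W ⟩
  Σ≤ n (λ i → ℕ→ℚ (n C i) * Σ≤ m (λ j → β j * W i j))
    ≡⟨ Σ≤-cong n (λ i _ → cong (ℕ→ℚ (n C i) *_) (trans (patchSum-linear F t i m β (λ j e → convPow ω e j))
         (patchSum-cong F t i (λ e → binomial-convolve-ωPow K e m)))) ⟩
  Σ≤ n (λ i → ℕ→ℚ (n C i) * patchworkTerm F n m t i) ∎
  where
  K = n C 2
  Y = substU (substW (Patch F))
  β : ℕ → ℚ
  β j = mul1+w^ K δ0 (m ∸ j)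
  W : ℕ → ℕ → ℚ
  W i j = patchSum F t i (λ e → convPow ω e j)


-- Theorem 5.4.
theorem5p4 : (F : Family) → IsoClosed F → (n m t : ℕ) →
    ℕ→ℚ (SG F n m t) ≡
    ℕ→ℚ (n !) * coeff ((substU (substW (Patch F)) ⊛ expZ) ⊛ binomW (n C 2)) n m t
theorem5p4 F _ n m t = begin
  ℕ→ℚ (SG F n m t)
    ≡⟨ SG-as-patchworks F n m t ⟩
  Σ≤ n (λ i → ℕ→ℚ (n C i) * patchworkTerm F n m t i)
    ≡⟨ coefficient-as-patchworks F n m t ⟨
  ℕ→ℚ (n !) * coeff ((substU (substW (Patch F)) ⊛ expZ) ⊛ binomW (n C 2)) n m t ∎
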